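{- Let $n,t\in\mathbb N$ with $t\le n-1$. Let $\mathcal F(n,t)$ be the class of forests on vertex set $[n]$ consisting of exactly $t$ trees such that the vertices $1,\dots,t$ lie in pairwise different trees, let $F$ be chosen uniformly at random from $\mathcal F(n,t)$, and let $(d_F(1),\dots,d_F(n))$ be its degree sequence. Throw $n-t-1$ balls independently and uniformly at random into $n$ bins $B_1,\dots,B_n$ and let $L_j$ be the number of balls in $B_j$. Independently, let $R$ be uniform on $[t]$ and for $j\in[t]$ let $I_j=1$ if $R=j$ and $I_j=0$ otherwise. Then $$(L_1+I_1,\dots,L_t+I_t,\,L_{t+1}+1,\dots,L_n+1)$$ has the same distribution as $(d_F(1),\dots,d_F(n))$.
   Context: $[n]=\{1,\dots,n\}$; $d_F(v)$ is the degree of vertex $v$ in $F$. -}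

module Defs where

open import Data.Nat using (ℕ; zero; suc; _+_; _<_)
open import Data.Fin using (Fin; zero; suc; toℕ; inject₁; fromℕ)
open import Data.List using (List; []; _∷_; map; concatMap; cartesianProduct; length)
open import Data.Nat.ListAction using () renaming (sum to lsum)
open import Data.Bool using (Bool; true; false; if_then_else_)
open import Data.Product using (Σ; _×_; _,_)
open import Relation.Binary.PropositionalEquality using (_≡_)
open import Relation.Nullary using (¬_)
open import Function.Definitions using (Injective)
open import Data.Fin using (_≟_)
open import Relation.Nullary.Decidable using (⌊_⌋)
open import Data.List using (allFin)

cons : ∀ {A : Set} {k : ℕ} → A → (Fin k → A) → Fin (suc k) → A
cons x f zero    = x
cons x f (suc i) = f i

allFuns : ∀ {A : Set} → List A → (k : ℕ) → List (Fin k → A)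
allFuns xs zero    = (λ ()) ∷ []
allFuns xs (suc k) = concatMap (λ x → map (cons x) (allFuns xs k)) xs

data Count {A : Set} (P : A → Set) : List A → ℕ → Set where
  c-nil  : Count P [] 0
  c-yes  : ∀ {x xs k} → P x → Count P xs k → Count P (x ∷ xs) (suc k)
  c-no   : ∀ {x xs k} → ¬ P x → Count P xs k → Count P (x ∷ xs) k

-- Graphs on the vertex set [n] (represented as Fin n; vertex i+1 ↔ i)

Adj : ℕ → Set
Adj n = Fin n → Fin n → Bool

allAdj : (n : ℕ) → List (Adj n)
allAdj n = allFuns (allFuns (true ∷ false ∷ []) n) n

IsSimpleGraph : ∀ {n} → Adj n → Set
IsSimpleGraph {n} G = (∀ (i j : Fin n) → G i j ≡ G j i) × (∀ (i : Fin n) → G i i ≡ false)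

data Reach {n : ℕ} (G : Adj n) : Fin n → Fin n → Set where
  here : ∀ {u} → Reach G u u
  step : ∀ {u w v} → G u w ≡ true → Reach G w v → Reach G u v

HasCycle : ∀ {n} → Adj n → Set
HasCycle {n} G =
  Σ ℕ λ m → Σ (Fin (3 + m) → Fin n) λ c →
    Injective _≡_ _≡_ c ×
    (∀ (i : Fin (2 + m)) → G (c (inject₁ i)) (c (suc i)) ≡ true) ×
    G (c (fromℕ (2 + m))) (c zero) ≡ true

IsForest : ∀ {n} → Adj n → Set
IsForest G = IsSimpleGraph G × ¬ HasCycle G

-- G has exactly t connected components: t pairwise disconnected
-- representatives such that every vertex is connected to one of them
HasComponents : ∀ {n} → Adj n → ℕ → Set
HasComponents {n} G t =
  Σ (Fin t → Fin n) λ r →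
    (∀ i j → Reach G (r i) (r j) → i ≡ j) ×
    (∀ v → Σ (Fin t) λ i → Reach G v (r i))

-- the vertices 1,…,t (i.e. Fin-indices 0,…,t-1) lie in pairwise different trees
FirstSeparated : ∀ {n} → Adj n → ℕ → Set
FirstSeparated {n} G t =
  ∀ (u v : Fin n) → toℕ u < t → toℕ v < t → Reach G u v → u ≡ v

InF : (n t : ℕ) → Adj n → Set
InF n t G = IsForest G × HasComponents G t × FirstSeparated G t

deg : ∀ {n} → Adj n → Fin n → ℕ
deg {n} G v = lsum (map (λ u → if G v u then 1 else 0) (allFin n))

DegSeq : ∀ {n} → Adj n → (Fin n → ℕ) → Set
DegSeq {n} G d = ∀ (v : Fin n) → deg G v ≡ d v

-- balls b : Fin m → Fin n (ball k goes into bin b k); R : Fin t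
Outcome : (m n t : ℕ) → Set
Outcome m n t = (Fin m → Fin n) × Fin t

outcomes : (m n t : ℕ) → List (Outcome m n t)
outcomes m n t = cartesianProduct (allFuns (allFin n) m) (allFin t)

load : ∀ {m n} → (Fin m → Fin n) → Fin n → ℕ
load {m} b j = lsum (map (λ k → if ⌊ b k ≟ j ⌋ then 1 else 0) (allFin m))

ballVec : ∀ {m n t} → Outcome m n t → Fin n → ℕ
ballVec {m} {n} {t} (b , R) j with toℕ j Data.Nat.<? t
... | Relation.Nullary.yes _ = load b j + (if ⌊ toℕ R Data.Nat.≟ toℕ j ⌋ then 1 else 0)
... | Relation.Nullary.no  _ = load b j + 1

BallVecIs : ∀ {m n t} → (Fin n → ℕ) → Outcome m n t → Set
BallVecIs {m} {n} {t} d o = ∀ (j : Fin n) → ballVec o j ≡ d j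

{-# OPTIONS --safe #-}
-- Call H a partial forest for a set A of active non-root vertices and a function c if H is a
-- forest whose edges end in roots or active vertices, every active vertex is joined to a root,
-- the roots 1, …, t lie in different trees, and every v has degree c v + [v ∈ A]. If |A| = s + 1,
-- these are as many as the placements of s balls together with R ∈ [t] whose occupancies
-- L_j + I_j equal c. If no active w has c w = 0, both counts vanish: a partial forest has an
-- active leaf, and s balls cannot reach all s + 1 active bins. Otherwise such a w is a leaf;
-- removing the edge to its parent u, deactivating w and lowering c u by one corresponds to the
-- first ball landing in bin u, and when w is the last active vertex its parent is the root R.
-- For A the set of non-roots the partial forests are the members of 𝓕(n,t), so kF and kB both
-- equal this count for c = d − [non-root], and summing over all c shows that N is the number
-- of outcomes.
module Submission where

open import Defs
open import Data.Nat
  using (ℕ; zero; suc; _+_; _*_; _∸_; _≤_; _<_; z≤n; s≤s; s<s; s<s⁻¹; _≤?_; _<?_; _≟_)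
open import Data.Nat.Properties
open import Algebra.Properties.CommutativeSemigroup +-commutativeSemigroup
  using () renaming (interchange to +-interchange)
open import Data.Nat.ListAction using () renaming (sum to lsum)
open import Data.Fin using (Fin; zero; suc; toℕ; inject₁; fromℕ; fromℕ<; inject≤; punchOut)
import Data.Fin.Properties as Finₚ
open import Data.List
  using (List; []; _∷_; _++_; map; concatMap; cartesianProduct; length; lookup; allFin; upTo; applyUpTo; tabulate)
open import Data.List.Membership.Propositional using (_∈_; _∉_)
open import Data.List.Membership.Propositional.Properties using (∈-∃++; ∈-lookup; ∈-++⁺ˡ; ∈-++⁺ʳ)
open import Data.List.Relation.Unary.Any using (here; there)
open import Data.Vec.Functional.Relation.Binary.Pointwise using (Pointwise)
open import Relation.Binary.Core using (_Preserves_⟶_)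
open import Data.Bool using (Bool; true; false; if_then_else_; not)
open import Data.Bool.Properties using (not-¬; not-injective)
import Data.Bool as Bool
open import Data.Product using (Σ; _×_; _,_; proj₁; proj₂)
open import Data.Sum using (_⊎_; inj₁; inj₂; swap)
open import Data.Empty using (⊥; ⊥-elim)
open import Data.Unit using (⊤; tt)
open import Function.Definitions using (Injective)
open import Function.Bundles using (_⇔_; mk⇔; Equivalence)
open import Relation.Nullary using (¬_; Dec; yes; no)
open import Relation.Nullary.Decidable using (⌊_⌋; map′; _×-dec_; ¬?)
open import Relation.Binary.PropositionalEquality

private
  variable
    A B : Set

bools : List Bool
bools = true ∷ false ∷ []

toℕᵇ : Bool → ℕ
toℕᵇ true  = 1
toℕᵇ false = 0

if-1-0≡toℕᵇ : ∀ b → (if b then 1 else 0) ≡ toℕᵇ b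
if-1-0≡toℕᵇ true  = refl
if-1-0≡toℕᵇ false = refl

toℕᵇ≤1 : ∀ b → toℕᵇ b ≤ 1
toℕᵇ≤1 true  = ≤-refl
toℕᵇ≤1 false = z≤n

-- A boolean equality test on Fin that, unlike ⌊ _≟_ ⌋, computes on constructors.
_==_ : ∀ {n} → Fin n → Fin n → Bool
zero  == zero  = true
zero  == suc j = false
suc i == zero  = false
suc i == suc j = i == j

==-refl : ∀ {n} (i : Fin n) → (i == i) ≡ true
==-refl zero    = refl
==-refl (suc i) = ==-refl i

==-sound : ∀ {n} (i j : Fin n) → (i == j) ≡ true → i ≡ j
==-sound zero    zero    e = refl
==-sound (suc i) (suc j) e = cong suc (==-sound i j e)

==-≢ : ∀ {n} (i j : Fin n) → i ≢ j → (i == j) ≡ false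
==-≢ i j i≢j with i == j in eq
... | true  = ⊥-elim (i≢j (==-sound i j eq))
... | false = refl

⌊≟⌋≡== : ∀ {n} (i j : Fin n) → ⌊ i Finₚ.≟ j ⌋ ≡ (i == j)
⌊≟⌋≡== i j with i Finₚ.≟ j
... | yes refl = sym (==-refl i)
... | no i≢j   = sym (==-≢ i j i≢j)

injective⇒surjective : ∀ {k} (σ : Fin k → Fin k) → Injective _≡_ _≡_ σ → ∀ i → Σ (Fin k) λ j → σ j ≡ i
injective⇒surjective {suc k} σ σ-inj i with Finₚ.any? (λ j → σ j Finₚ.≟ i)
... | yes found = found
... | no missed = ⊥-elim (<-irrefl refl (Finₚ.injective⇒≤ {f = squeeze} squeeze-inj))
  where
  σ≢i : ∀ j → i ≢ σ j
  σ≢i j e = missed (j , sym e)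
  squeeze : Fin (suc k) → Fin k
  squeeze j = punchOut (σ≢i j)
  squeeze-inj : Injective _≡_ _≡_ squeeze
  squeeze-inj {x} {y} e = σ-inj (Finₚ.punchOut-injective (σ≢i x) (σ≢i y) e)

sumList : List A → (A → ℕ) → ℕ
sumList []       f = 0
sumList (x ∷ xs) f = f x + sumList xs f

sumFin : (n : ℕ) → (Fin n → ℕ) → ℕ
sumFin zero    f = 0
sumFin (suc n) f = f zero + sumFin n (λ i → f (suc i))

sumℕ : ℕ → (ℕ → ℕ) → ℕ
sumℕ zero    f = 0
sumℕ (suc k) f = f 0 + sumℕ k (λ i → f (suc i))

prodFin : (n : ℕ) → (Fin n → ℕ) → ℕ
prodFin zero    f = 1
prodFin (suc n) f = f zero * prodFin n (λ i → f (suc i))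

sumList-cong : ∀ (xs : List A) {f g : A → ℕ} → (∀ x → f x ≡ g x) → sumList xs f ≡ sumList xs g
sumList-cong []       f≗g = refl
sumList-cong (x ∷ xs) f≗g = cong₂ _+_ (f≗g x) (sumList-cong xs f≗g)

sumList-++ : ∀ (xs ys : List A) (f : A → ℕ) → sumList (xs ++ ys) f ≡ sumList xs f + sumList ys f
sumList-++ []       ys f = refl
sumList-++ (x ∷ xs) ys f = trans (cong (f x +_) (sumList-++ xs ys f)) (sym (+-assoc (f x) _ _))

sumList-map : ∀ (g : A → B) xs (f : B → ℕ) → sumList (map g xs) f ≡ sumList xs (λ x → f (g x))
sumList-map g []       f = refl
sumList-map g (x ∷ xs) f = cong (f (g x) +_) (sumList-map g xs f)

sumList-concatMap : ∀ (g : A → List B) xs (f : B → ℕ) →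
  sumList (concatMap g xs) f ≡ sumList xs (λ x → sumList (g x) f)
sumList-concatMap g []       f = refl
sumList-concatMap g (x ∷ xs) f =
  trans (sumList-++ (g x) (concatMap g xs) f) (cong (sumList (g x) f +_) (sumList-concatMap g xs f))

sumList-cartesianProduct : ∀ (xs : List A) (ys : List B) (f : A × B → ℕ) →
  sumList (cartesianProduct xs ys) f ≡ sumList xs (λ x → sumList ys (λ y → f (x , y)))
sumList-cartesianProduct []       ys f = refl
sumList-cartesianProduct (x ∷ xs) ys f = trans (sumList-++ (map (x ,_) ys) _ f)
  (cong₂ _+_ (sumList-map (x ,_) ys f) (sumList-cartesianProduct xs ys f))

sumList-tabulate : ∀ n (g : Fin n → A) (f : A → ℕ) → sumList (tabulate g) f ≡ sumFin n (λ i → f (g i))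
sumList-tabulate zero    g f = refl
sumList-tabulate (suc n) g f = cong (f (g zero) +_) (sumList-tabulate n (λ i → g (suc i)) f)

sumList-allFin : ∀ n (f : Fin n → ℕ) → sumList (allFin n) f ≡ sumFin n f
sumList-allFin n f = sumList-tabulate n (λ i → i) f

sumList-applyUpTo : ∀ k (g f : ℕ → ℕ) → sumList (applyUpTo g k) f ≡ sumℕ k (λ i → f (g i))
sumList-applyUpTo zero    g f = refl
sumList-applyUpTo (suc k) g f = cong (f (g 0) +_) (sumList-applyUpTo k (λ i → g (suc i)) f)

lsum-map≡sumList : ∀ (f : A → ℕ) xs → lsum (map f xs) ≡ sumList xs f
lsum-map≡sumList f []       = refl
lsum-map≡sumList f (x ∷ xs) = cong (f x +_) (lsum-map≡sumList f xs)

sumList-+ : ∀ (xs : List A) (f g : A → ℕ) → sumList xs (λ x → f x + g x) ≡ sumList xs f + sumList xs g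
sumList-+ []       f g = refl
sumList-+ (x ∷ xs) f g =
  trans (cong (f x + g x +_) (sumList-+ xs f g)) (+-interchange (f x) (g x) (sumList xs f) (sumList xs g))

sumList-*ˡ : ∀ (xs : List A) a (f : A → ℕ) → sumList xs (λ x → a * f x) ≡ a * sumList xs f
sumList-*ˡ []       a f = sym (*-zeroʳ a)
sumList-*ˡ (x ∷ xs) a f = trans (cong (a * f x +_) (sumList-*ˡ xs a f)) (sym (*-distribˡ-+ a (f x) _))

sumList-zero : ∀ (xs : List A) (f : A → ℕ) → (∀ x → f x ≡ 0) → sumList xs f ≡ 0
sumList-zero []       f f≡0 = refl
sumList-zero (x ∷ xs) f f≡0 rewrite f≡0 x = sumList-zero xs f f≡0

sumList-swap : ∀ (xs : List A) (ys : List B) (f : A → B → ℕ) →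
  sumList xs (λ x → sumList ys (f x)) ≡ sumList ys (λ y → sumList xs (λ x → f x y))
sumList-swap []       ys f = sym (sumList-zero ys _ (λ _ → refl))
sumList-swap (x ∷ xs) ys f = trans (cong (sumList ys (f x) +_) (sumList-swap xs ys f))
  (sym (sumList-+ ys (f x) (λ y → sumList xs (λ x′ → f x′ y))))

sumList-1≡length : ∀ (xs : List A) → sumList xs (λ _ → 1) ≡ length xs
sumList-1≡length []       = refl
sumList-1≡length (x ∷ xs) = cong suc (sumList-1≡length xs)

sumFin-cong : ∀ n {f g : Fin n → ℕ} → (∀ i → f i ≡ g i) → sumFin n f ≡ sumFin n g
sumFin-cong zero    f≗g = refl
sumFin-cong (suc n) f≗g = cong₂ _+_ (f≗g zero) (sumFin-cong n (λ i → f≗g (suc i)))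

sumFin-mono : ∀ n {f g : Fin n → ℕ} → (∀ i → f i ≤ g i) → sumFin n f ≤ sumFin n g
sumFin-mono zero    f≤g = z≤n
sumFin-mono (suc n) f≤g = +-mono-≤ (f≤g zero) (sumFin-mono n (λ i → f≤g (suc i)))

sumFin-zero : ∀ n (f : Fin n → ℕ) → (∀ i → f i ≡ 0) → sumFin n f ≡ 0
sumFin-zero zero    f f≡0 = refl
sumFin-zero (suc n) f f≡0 rewrite f≡0 zero = sumFin-zero n _ (λ i → f≡0 (suc i))

sumFin-1 : ∀ n → sumFin n (λ _ → 1) ≡ n
sumFin-1 zero    = refl
sumFin-1 (suc n) = cong suc (sumFin-1 n)

term≤sumFin : ∀ n (f : Fin n → ℕ) i → f i ≤ sumFin n f
term≤sumFin (suc n) f zero    = m≤m+n (f zero) _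
term≤sumFin (suc n) f (suc i) = ≤-trans (term≤sumFin n _ i) (m≤n+m _ (f zero))

sumFin-== : ∀ n (i : Fin n) → sumFin n (λ j → toℕᵇ (i == j)) ≡ 1
sumFin-== (suc n) zero    = cong suc (sumFin-zero n _ (λ _ → refl))
sumFin-== (suc n) (suc i) = sumFin-== n i

sumFin-toℕ : ∀ n (f : ℕ → ℕ) → sumFin n (λ i → f (toℕ i)) ≡ sumℕ n f
sumFin-toℕ zero    f = refl
sumFin-toℕ (suc n) f = cong (f 0 +_) (sumFin-toℕ n (λ i → f (suc i)))

sumℕ-zero : ∀ k (f : ℕ → ℕ) → (∀ i → f i ≡ 0) → sumℕ k f ≡ 0
sumℕ-zero zero    f f≡0 = refl
sumℕ-zero (suc k) f f≡0 rewrite f≡0 0 = sumℕ-zero k _ (λ i → f≡0 (suc i))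

sumℕ-cong : ∀ k {f g : ℕ → ℕ} → (∀ i → f i ≡ g i) → sumℕ k f ≡ sumℕ k g
sumℕ-cong zero    f≗g = refl
sumℕ-cong (suc k) f≗g = cong₂ _+_ (f≗g 0) (sumℕ-cong k (λ i → f≗g (suc i)))

sumFin-update : ∀ n (a : Fin n) (f g : Fin n → ℕ) → (∀ j → a ≢ j → f j ≡ g j) →
  sumFin n f + g a ≡ sumFin n g + f a
sumFin-update (suc n) zero f g f≗g
  rewrite sumFin-cong n {λ i → f (suc i)} {λ i → g (suc i)} (λ i → f≗g (suc i) (λ ())) =
  trans (+-assoc (f zero) _ _) (trans (+-comm (f zero) _) (cong (_+ f zero) (+-comm _ (g zero))))
sumFin-update (suc n) (suc a) f g f≗g = begin
  f zero + sumFin n (λ i → f (suc i)) + g (suc a)   ≡⟨ +-assoc (f zero) _ _ ⟩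
  f zero + (sumFin n (λ i → f (suc i)) + g (suc a)) ≡⟨ cong₂ _+_ (f≗g zero (λ ())) rest ⟩
  g zero + (sumFin n (λ i → g (suc i)) + f (suc a)) ≡⟨ sym (+-assoc (g zero) _ _) ⟩
  g zero + sumFin n (λ i → g (suc i)) + f (suc a)   ∎
  where
  open ≡-Reasoning
  rest : sumFin n (λ i → f (suc i)) + g (suc a) ≡ sumFin n (λ i → g (suc i)) + f (suc a)
  rest = sumFin-update n a (λ i → f (suc i)) (λ i → g (suc i))
           (λ j a≢j → f≗g (suc j) (λ e → a≢j (Finₚ.suc-injective e)))

sumFin-+ : ∀ n (f g : Fin n → ℕ) → sumFin n (λ i → f i + g i) ≡ sumFin n f + sumFin n g
sumFin-+ n f g = trans (sym (sumList-allFin n _))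
  (trans (sumList-+ (allFin n) f g) (cong₂ _+_ (sumList-allFin n f) (sumList-allFin n g)))

sumFin-swap : ∀ k m (f : Fin k → Fin m → ℕ) →
  sumFin k (λ i → sumFin m (f i)) ≡ sumFin m (λ j → sumFin k (λ i → f i j))
sumFin-swap k m f = begin
  sumFin k (λ i → sumFin m (f i))                  ≡⟨ sym (sumList-allFin k _) ⟩
  sumList (allFin k) (λ i → sumFin m (f i))        ≡⟨ sumList-cong (allFin k) (λ i → sym (sumList-allFin m (f i))) ⟩
  sumList (allFin k) (λ i → sumList (allFin m) (f i)) ≡⟨ sumList-swap (allFin k) (allFin m) f ⟩
  sumList (allFin m) (λ j → sumList (allFin k) (λ i → f i j)) ≡⟨ sumList-cong (allFin m) (λ j → sumList-allFin k _) ⟩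
  sumList (allFin m) (λ j → sumFin k (λ i → f i j)) ≡⟨ sumList-allFin m _ ⟩
  sumFin m (λ j → sumFin k (λ i → f i j))          ∎
  where open ≡-Reasoning

data Indicator (P : Set) : ℕ → Set where
  holds : P → Indicator P 1
  fails : ¬ P → Indicator P 0

indicator : {P : Set} → Dec P → ℕ
indicator (yes _) = 1
indicator (no _)  = 0

indicator-spec : {P : Set} (P? : Dec P) → Indicator P (indicator P?)
indicator-spec (yes p) = holds p
indicator-spec (no ¬p) = fails ¬p

module _ {P Q : Set} where

  Indicator-≡ : ∀ {x y} → Indicator P x → Indicator Q y → (P → Q) → (Q → P) → x ≡ y
  Indicator-≡ (holds p) (holds q) P→Q Q→P = refl
  Indicator-≡ (holds p) (fails ¬q) P→Q Q→P = ⊥-elim (¬q (P→Q p))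
  Indicator-≡ (fails ¬p) (holds q) P→Q Q→P = ⊥-elim (¬p (Q→P q))
  Indicator-≡ (fails ¬p) (fails ¬q) P→Q Q→P = refl

  Indicator-⇔ : ∀ {x} → Indicator P x → (P → Q) → (Q → P) → Indicator Q x
  Indicator-⇔ (holds p) P→Q Q→P = holds (P→Q p)
  Indicator-⇔ (fails ¬p) P→Q Q→P = fails (λ q → ¬p (Q→P q))

  Indicator-× : ∀ {x y} → Indicator P x → Indicator Q y → Indicator (P × Q) (x * y)
  Indicator-× (holds p) (holds q) = holds (p , q)
  Indicator-× (holds p) (fails ¬q) = fails (λ pq → ¬q (proj₂ pq))
  Indicator-× (fails ¬p) _ = fails (λ pq → ¬p (proj₁ pq))

Indicator-holds : ∀ {P x} → Indicator P x → P → x ≡ 1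
Indicator-holds (holds _) _ = refl
Indicator-holds (fails ¬p) p = ⊥-elim (¬p p)

Indicator-fails : ∀ {P x} → Indicator P x → ¬ P → x ≡ 0
Indicator-fails (holds p) ¬p = ⊥-elim (¬p p)
Indicator-fails (fails _) _ = refl

Indicator-toℕᵇ : ∀ b → Indicator (b ≡ true) (toℕᵇ b)
Indicator-toℕᵇ true  = holds refl
Indicator-toℕᵇ false = fails (λ ())

Indicator-∀ : ∀ n {P : Fin n → Set} (f : Fin n → ℕ) → (∀ i → Indicator (P i) (f i)) →
  Indicator (∀ i → P i) (prodFin n f)
Indicator-∀ zero    f 𝟙P = holds (λ ())
Indicator-∀ (suc n) f 𝟙P =
  Indicator-⇔ (Indicator-× (𝟙P zero) (Indicator-∀ n (λ i → f (suc i)) (λ i → 𝟙P (suc i))))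
    (λ { (p₀ , ps) zero → p₀ ; (p₀ , ps) (suc i) → ps i })
    (λ ps → ps zero , (λ i → ps (suc i)))

count≡sumList : ∀ {P : A → Set} {xs k} (φ : A → ℕ) →
  Count P xs k → (∀ x → Indicator (P x) (φ x)) → k ≡ sumList xs φ
count≡sumList φ c-nil 𝟙P = refl
count≡sumList φ (c-yes {x = x} p c) 𝟙P rewrite Indicator-holds (𝟙P x) p = cong suc (count≡sumList φ c 𝟙P)
count≡sumList φ (c-no {x = x} ¬p c) 𝟙P rewrite Indicator-fails (𝟙P x) ¬p = count≡sumList φ c 𝟙P

count-none : ∀ {P : A → Set} {xs k} → Count P xs k → (∀ x → ¬ P x) → k ≡ 0
count-none {xs = xs} count none =
  trans (count≡sumList (λ _ → 0) count (λ x → fails (none x))) (sumList-zero xs _ (λ _ → refl))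

sumℕ-prefix : ∀ m s (φ : ℕ → ℕ) → s ≤ m → sumℕ m (λ i → indicator (i <? s) * φ i) ≡ sumℕ s φ
sumℕ-prefix m zero φ _ = sumℕ-zero m _ (λ i → cong (_* φ i) (Indicator-fails (indicator-spec (i <? 0)) (λ ())))
sumℕ-prefix (suc m) (suc s) φ (s≤s s≤m) = cong₂ _+_ (+-identityʳ (φ 0))
  (trans (sumℕ-cong m (λ i → cong (_* φ (suc i))
           (Indicator-≡ (indicator-spec (suc i <? suc s)) (indicator-spec (i <? s)) s<s⁻¹ s<s)))
         (sumℕ-prefix m s (λ i → φ (suc i)) s≤m))

sumFin-prefix : ∀ {n t} (φ : ℕ → ℕ) → t ≤ n →
  sumFin n (λ u → indicator (toℕ u <? t) * φ (toℕ u)) ≡ sumFin t (λ R → φ (toℕ R))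
sumFin-prefix {n} {t} φ t≤n = trans (sumFin-toℕ n (λ i → indicator (i <? t) * φ i))
  (trans (sumℕ-prefix n t φ t≤n) (sym (sumFin-toℕ t φ)))

sumℕ-δ : ∀ k y → y < k → sumℕ k (λ x → indicator (x ≟ y)) ≡ 1
sumℕ-δ (suc k) zero    _ = cong suc (sumℕ-zero k _ (λ i → Indicator-fails (indicator-spec (suc i ≟ 0)) (λ ())))
sumℕ-δ (suc k) (suc y) (s≤s y<k) = trans
  (sumℕ-cong k (λ i → Indicator-≡ (indicator-spec (suc i ≟ suc y)) (indicator-spec (i ≟ y)) suc-injective (cong suc)))
  (sumℕ-δ k y y<k)

sumList-allFuns-suc : ∀ (xs : List A) k (ψ : (Fin (suc k) → A) → ℕ) →
  sumList (allFuns xs (suc k)) ψ ≡ sumList xs (λ x → sumList (allFuns xs k) (λ g → ψ (cons x g)))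
sumList-allFuns-suc xs k ψ = trans (sumList-concatMap (λ x → map (cons x) (allFuns xs k)) xs ψ)
  (sumList-cong xs (λ x → sumList-map (cons x) (allFuns xs k) ψ))

update : ∀ {k} → (Fin k → A) → Fin k → (A → A) → Fin k → A
update f i σ j = if j == i then σ (f j) else f j

decrement : ∀ {n} → (Fin n → ℕ) → Fin n → Fin n → ℕ
decrement c u v = if v == u then c v ∸ 1 else c v

decrement-self : ∀ {n} (c : Fin n → ℕ) u → decrement c u u ≡ c u ∸ 1
decrement-self c u rewrite ==-refl u = refl

decrement-other : ∀ {n} (c : Fin n → ℕ) u v → v ≢ u → decrement c u v ≡ c v
decrement-other c u v v≢u rewrite ==-≢ v u v≢u = refl

sumList-allFuns-update : ∀ (R : A → A → Set) → (∀ x → R x x) → ∀ (xs : List A) (σ : A → A) →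
  (∀ φ → φ Preserves R ⟶ _≡_ → sumList xs (λ x → φ (σ x)) ≡ sumList xs φ) →
  ∀ k (i : Fin k) (ψ : (Fin k → A) → ℕ) → ψ Preserves Pointwise R ⟶ _≡_ →
  sumList (allFuns xs k) (λ f → ψ (update f i σ)) ≡ sumList (allFuns xs k) ψ
sumList-allFuns-update R R-refl xs σ σ-perm (suc k) i ψ ψ-resp = begin
  sumList (allFuns xs (suc k)) (λ f → ψ (update f i σ))
    ≡⟨ sumList-allFuns-suc xs k _ ⟩
  sumList xs (λ x → sumList (allFuns xs k) (λ g → ψ (update (cons x g) i σ)))
    ≡⟨ inner i ⟩
  sumList xs (λ x → sumList (allFuns xs k) (λ g → ψ (cons x g)))
    ≡⟨ sym (sumList-allFuns-suc xs k _) ⟩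
  sumList (allFuns xs (suc k)) ψ ∎
  where
  open ≡-Reasoning
  ψ-cons-resp : ∀ {x y g h} → R x y → Pointwise R g h → ψ (cons x g) ≡ ψ (cons y h)
  ψ-cons-resp x~y g~h = ψ-resp (λ { zero → x~y ; (suc j) → g~h j })
  update-zero : ∀ x g → ψ (update (cons x g) zero σ) ≡ ψ (cons (σ x) g)
  update-zero x g = ψ-resp (λ { zero → R-refl _ ; (suc j) → R-refl _ })
  update-suc : ∀ x g i → ψ (update (cons x g) (suc i) σ) ≡ ψ (cons x (update g i σ))
  update-suc x g i = ψ-resp (λ { zero → R-refl _ ; (suc j) → R-refl _ })
  inner : ∀ i → sumList xs (λ x → sumList (allFuns xs k) (λ g → ψ (update (cons x g) i σ)))
             ≡ sumList xs (λ x → sumList (allFuns xs k) (λ g → ψ (cons x g)))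
  inner zero = trans
    (sumList-cong xs (λ x → sumList-cong (allFuns xs k) (update-zero x)))
    (σ-perm (λ x → sumList (allFuns xs k) (λ g → ψ (cons x g)))
            (λ x~y → sumList-cong (allFuns xs k) (λ g → ψ-cons-resp x~y (λ _ → R-refl _))))
  inner (suc i) = sumList-cong xs (λ x → trans
    (sumList-cong (allFuns xs k) (λ g → update-suc x g i))
    (sumList-allFuns-update R R-refl xs σ σ-perm k i (λ g → ψ (cons x g)) (ψ-cons-resp (R-refl x))))

-- With δ x y read as [x = y]: every g with values in S occurs exactly once in allFuns xs k.
sumList-allFuns-δ : ∀ (δ : A → A → ℕ) (S : A → Set) (xs : List A) →
  (∀ y → S y → sumList xs (λ x → δ x y) ≡ 1) →
  ∀ k (g : Fin k → A) → (∀ i → S (g i)) →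
  sumList (allFuns xs k) (λ f → prodFin k (λ i → δ (f i) (g i))) ≡ 1
sumList-allFuns-δ δ S xs δ-once zero    g g∈S = refl
sumList-allFuns-δ {A = A′} δ S xs δ-once (suc k) g g∈S = begin
  sumList (allFuns xs (suc k)) (λ f → prodFin (suc k) (λ i → δ (f i) (g i)))
    ≡⟨ sumList-allFuns-suc xs k _ ⟩
  sumList xs (λ x → sumList (allFuns xs k) (λ f → δ x (g zero) * rest f))
    ≡⟨ sumList-cong xs (λ x → sumList-*ˡ (allFuns xs k) (δ x (g zero)) rest) ⟩
  sumList xs (λ x → δ x (g zero) * sumList (allFuns xs k) rest)
    ≡⟨ sumList-cong xs (λ x → cong (δ x (g zero) *_) rest≡1) ⟩
  sumList xs (λ x → δ x (g zero) * 1)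
    ≡⟨ sumList-cong xs (λ x → *-identityʳ _) ⟩
  sumList xs (λ x → δ x (g zero))
    ≡⟨ δ-once (g zero) (g∈S zero) ⟩
  1 ∎
  where
  open ≡-Reasoning
  rest : (Fin k → A′) → ℕ
  rest f = prodFin k (λ i → δ (f i) (g (suc i)))
  rest≡1 : sumList (allFuns xs k) rest ≡ 1
  rest≡1 = sumList-allFuns-δ δ S xs δ-once k (λ i → g (suc i)) (λ i → g∈S (suc i))

module _ {n : ℕ} where

  open import Data.List.Membership.DecPropositional (Finₚ._≟_ {n}) using (_∈?_)

  _≗ᴬ_ : Adj n → Adj n → Set
  _≗ᴬ_ = Pointwise (Pointwise _≡_)

  _⊆ᴬ_ : Adj n → Adj n → Set
  G ⊆ᴬ G′ = ∀ i j → G i j ≡ true → G′ i j ≡ true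

  ≗ᴬ⇒⊆ᴬ : ∀ {G G′} → G ≗ᴬ G′ → G ⊆ᴬ G′
  ≗ᴬ⇒⊆ᴬ G≗G′ i j e = trans (sym (G≗G′ i j)) e

  ≗ᴬ-sym : ∀ {G G′} → G ≗ᴬ G′ → G′ ≗ᴬ G
  ≗ᴬ-sym G≗G′ i j = sym (G≗G′ i j)

  Symmetric : Adj n → Set
  Symmetric G = ∀ i j → G i j ≡ G j i

  reach-mono : ∀ {G G′ : Adj n} → G ⊆ᴬ G′ → ∀ {x y} → Reach G x y → Reach G′ x y
  reach-mono G⊆G′ here = here
  reach-mono G⊆G′ (step e r) = step (G⊆G′ _ _ e) (reach-mono G⊆G′ r)

  reach-trans : ∀ {G : Adj n} {x y z} → Reach G x y → Reach G y z → Reach G x z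
  reach-trans here r′ = r′
  reach-trans (step e r) r′ = step e (reach-trans r r′)

  reach-sym : ∀ {G : Adj n} → Symmetric G → ∀ {x y} → Reach G x y → Reach G y x
  reach-sym G-sym here = here
  reach-sym G-sym (step {u} {w} e r) = reach-trans (reach-sym G-sym r) (step (trans (G-sym w u) e) here)

  hasCycle-mono : ∀ {G G′ : Adj n} → G ⊆ᴬ G′ → HasCycle G → HasCycle G′
  hasCycle-mono G⊆G′ (m , c , c-inj , edges , closing) =
    m , c , c-inj , (λ i → G⊆G′ _ _ (edges i)) , G⊆G′ _ _ closing

  degree : Adj n → Fin n → ℕ
  degree H v = sumFin n (λ u → toℕᵇ (H v u))

  deg≡degree : ∀ (H : Adj n) v → deg H v ≡ degree H v
  deg≡degree H v = trans (lsum-map≡sumList _ (allFin n))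
    (trans (sumList-allFin n _) (sumFin-cong n (λ u → if-1-0≡toℕᵇ (H v u))))

  degree-cong : ∀ {H H′ : Adj n} → H ≗ᴬ H′ → ∀ v → degree H v ≡ degree H′ v
  degree-cong H≗H′ v = sumFin-cong n (λ u → cong toℕᵇ (H≗H′ v u))

  neighbour⇒degree≥1 : ∀ (H : Adj n) v u → H v u ≡ true → 1 ≤ degree H v
  neighbour⇒degree≥1 H v u e = ≤-trans (≤-reflexive (cong toℕᵇ (sym e))) (term≤sumFin n (λ u → toℕᵇ (H v u)) u)

  degree≡0⇒no-neighbour : ∀ (H : Adj n) v → degree H v ≡ 0 → ∀ u → H v u ≡ false
  degree≡0⇒no-neighbour H v d≡0 u with H v u in e
  ... | false = refl
  ... | true  = ⊥-elim (<⇒≱ (neighbour⇒degree≥1 H v u e) (≤-reflexive d≡0))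

  degree≥1⇒neighbour : ∀ (H : Adj n) v → 1 ≤ degree H v → Σ (Fin n) λ u → H v u ≡ true
  degree≥1⇒neighbour H v d≥1 with Finₚ.any? (λ u → H v u Bool.≟ true)
  ... | yes found = found
  ... | no none = ⊥-elim (<⇒≱ d≥1 (≤-reflexive (sumFin-zero n _ (λ u → cong toℕᵇ (not-true u)))))
    where
    not-true : ∀ u → H v u ≡ false
    not-true u with H v u in e
    ... | true  = ⊥-elim (none (u , e))
    ... | false = refl

  degree≤1 : ∀ (H : Adj n) v y → (∀ z → z ≢ y → H v z ≡ false) → degree H v ≤ 1
  degree≤1 H v y only-y = ≤-trans (sumFin-mono n below) (≤-reflexive (sumFin-== n y))
    where
    below : ∀ z → toℕᵇ (H v z) ≤ toℕᵇ (y == z)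
    below z with z Finₚ.≟ y
    ... | yes refl = subst (λ b → toℕᵇ (H v z) ≤ toℕᵇ b) (sym (==-refl z)) (toℕᵇ≤1 (H v z))
    ... | no z≢y rewrite only-y z z≢y = z≤n

  degree≥2⇒other-neighbour : ∀ (H : Adj n) v y → 2 ≤ degree H v → Σ (Fin n) λ z → z ≢ y × H v z ≡ true
  degree≥2⇒other-neighbour H v y d≥2 with Finₚ.any? (λ z → ¬? (z Finₚ.≟ y) ×-dec (H v z Bool.≟ true))
  ... | yes found = found
  ... | no none = ⊥-elim (≤⇒≯ (degree≤1 H v y absent) d≥2)
    where
    absent : ∀ z → z ≢ y → H v z ≡ false
    absent z z≢y with H v z in e
    ... | true  = ⊥-elim (none (z , z≢y , e))
    ... | false = refl

  degree≤n : ∀ (H : Adj n) v → degree H v ≤ n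
  degree≤n H v = ≤-trans (sumFin-mono n (λ u → toℕᵇ≤1 (H v u))) (≤-reflexive (sumFin-1 n))

  toggle : Fin n → Fin n → Adj n → Adj n
  toggle a b H = update H a (λ row → update row b not)

  toggle-other : ∀ a b (H : Adj n) i j → (i ≢ a ⊎ j ≢ b) → toggle a b H i j ≡ H i j
  toggle-other a b H i j off with i == a in i=a
  ... | false = refl
  ... | true with j == b in j=b
  ...   | false = refl
  ...   | true with off
  ...     | inj₁ i≢a = ⊥-elim (i≢a (==-sound i a i=a))
  ...     | inj₂ j≢b = ⊥-elim (j≢b (==-sound j b j=b))

  toggle-hit : ∀ a b (H : Adj n) → toggle a b H a b ≡ not (H a b)
  toggle-hit a b H rewrite ==-refl a | ==-refl b = refl

  toggle-cong : ∀ a b {H H′ : Adj n} → H ≗ᴬ H′ → toggle a b H ≗ᴬ toggle a b H′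
  toggle-cong a b H≗H′ i j with i == a
  ... | false = H≗H′ i j
  ... | true with j == b
  ...   | false = H≗H′ i j
  ...   | true  = cong not (H≗H′ i j)

  sumList-allAdj-toggle : ∀ a b (ψ : Adj n → ℕ) → ψ Preserves _≗ᴬ_ ⟶ _≡_ →
    sumList (allAdj n) (λ H → ψ (toggle a b H)) ≡ sumList (allAdj n) ψ
  sumList-allAdj-toggle a b ψ ψ-resp =
    sumList-allFuns-update (Pointwise _≡_) (λ _ _ → refl) (allFuns bools n) (λ row → update row b not)
      (λ φ φ-resp → sumList-allFuns-update _≡_ (λ _ → refl) bools not not-perm n b φ φ-resp)
      n a ψ ψ-resp
    where
    not-perm : ∀ φ → φ Preserves _≡_ ⟶ _≡_ → sumList bools (λ x → φ (not x)) ≡ sumList bools φ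
    not-perm φ _ = trans (cong (φ false +_) (+-identityʳ _))
      (trans (+-comm (φ false) (φ true)) (cong (φ true +_) (sym (+-identityʳ _))))

  sumList-allAdj-δ : ∀ (G : Adj n) →
    sumList (allAdj n) (λ H → prodFin n (λ i → prodFin n (λ j → indicator (H i j Bool.≟ G i j)))) ≡ 1
  sumList-allAdj-δ G =
    sumList-allFuns-δ (λ row g → prodFin n (λ j → indicator (row j Bool.≟ g j))) (λ _ → ⊤) (allFuns bools n)
      (λ g _ → sumList-allFuns-δ (λ x y → indicator (x Bool.≟ y)) (λ _ → ⊤) bools
                 (λ { true _ → refl ; false _ → refl }) n g (λ _ → tt))
      n G (λ _ → tt)

  toggleEdge : Fin n → Fin n → Adj n → Adj n
  toggleEdge w u H = toggle w u (toggle u w H)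

  toggleEdge-other : ∀ w u (H : Adj n) i j → (i ≢ w ⊎ j ≢ u) → (i ≢ u ⊎ j ≢ w) →
    toggleEdge w u H i j ≡ H i j
  toggleEdge-other w u H i j off₁ off₂ = trans (toggle-other w u (toggle u w H) i j off₁) (toggle-other u w H i j off₂)

  toggleEdge-wu : ∀ w u (H : Adj n) → w ≢ u → toggleEdge w u H w u ≡ not (H w u)
  toggleEdge-wu w u H w≢u = trans (toggle-hit w u (toggle u w H)) (cong not (toggle-other u w H w u (inj₁ w≢u)))

  toggleEdge-uw : ∀ w u (H : Adj n) → w ≢ u → toggleEdge w u H u w ≡ not (H u w)
  toggleEdge-uw w u H w≢u = trans (toggle-other w u (toggle u w H) u w (inj₁ (λ e → w≢u (sym e)))) (toggle-hit u w H)

  toggleEdge-diagonal : ∀ w u (H : Adj n) → w ≢ u → ∀ i → toggleEdge w u H i i ≡ H i i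
  toggleEdge-diagonal w u H w≢u i with i Finₚ.≟ w
  ... | yes refl = toggleEdge-other w u H i i (inj₂ w≢u) (inj₁ w≢u)
  ... | no i≢w   = toggleEdge-other w u H i i (inj₁ i≢w) (inj₂ i≢w)

  data EdgePosition (w u i j : Fin n) : Set where
    at-wu     : i ≡ w → j ≡ u → EdgePosition w u i j
    at-uw     : i ≡ u → j ≡ w → EdgePosition w u i j
    elsewhere : (i ≢ w ⊎ j ≢ u) → (i ≢ u ⊎ j ≢ w) → EdgePosition w u i j

  edgePosition : ∀ w u i j → EdgePosition w u i j
  edgePosition w u i j with i Finₚ.≟ w | j Finₚ.≟ u | i Finₚ.≟ u | j Finₚ.≟ w
  ... | yes i≡w | yes j≡u | _       | _       = at-wu i≡w j≡u
  ... | _       | _       | yes i≡u | yes j≡w = at-uw i≡u j≡w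
  ... | no i≢w  | _       | no i≢u  | _       = elsewhere (inj₁ i≢w) (inj₁ i≢u)
  ... | no i≢w  | _       | yes _   | no j≢w  = elsewhere (inj₁ i≢w) (inj₂ j≢w)
  ... | yes _   | no j≢u  | no i≢u  | _       = elsewhere (inj₂ j≢u) (inj₁ i≢u)
  ... | yes _   | no j≢u  | yes _   | no j≢w  = elsewhere (inj₂ j≢u) (inj₂ j≢w)

  toggleEdge-symmetric : ∀ w u (H : Adj n) → w ≢ u → Symmetric H → Symmetric (toggleEdge w u H)
  toggleEdge-symmetric w u H w≢u H-sym i j with edgePosition w u i j
  ... | at-wu refl refl =
    trans (toggleEdge-wu w u H w≢u) (trans (cong not (H-sym w u)) (sym (toggleEdge-uw w u H w≢u)))
  ... | at-uw refl refl =
    trans (toggleEdge-uw w u H w≢u) (trans (cong not (H-sym u w)) (sym (toggleEdge-wu w u H w≢u)))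
  ... | elsewhere off₁ off₂ = trans (toggleEdge-other w u H i j off₁ off₂)
    (trans (H-sym i j) (sym (toggleEdge-other w u H j i (swap off₂) (swap off₁))))

  sumList-allAdj-toggleEdge : ∀ w u (ψ : Adj n → ℕ) → ψ Preserves _≗ᴬ_ ⟶ _≡_ →
    sumList (allAdj n) (λ H → ψ (toggleEdge w u H)) ≡ sumList (allAdj n) ψ
  sumList-allAdj-toggleEdge w u ψ ψ-resp =
    trans (sumList-allAdj-toggle u w (λ H → ψ (toggle w u H)) (λ H≗H′ → ψ-resp (toggle-cong w u H≗H′)))
          (sumList-allAdj-toggle w u ψ ψ-resp)

  module EdgeRemoval {w u : Fin n} (w≢u : w ≢ u) {H : Adj n} (Hwu : H w u ≡ true) (Huw : H u w ≡ true) where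

    H⁻ : Adj n
    H⁻ = toggleEdge w u H

    H⁻wu : H⁻ w u ≡ false
    H⁻wu = trans (toggleEdge-wu w u H w≢u) (cong not Hwu)

    H⁻uw : H⁻ u w ≡ false
    H⁻uw = trans (toggleEdge-uw w u H w≢u) (cong not Huw)

    H⁻⊆H : H⁻ ⊆ᴬ H
    H⁻⊆H i j e with edgePosition w u i j
    ... | at-wu refl refl = ⊥-elim (not-¬ e H⁻wu)
    ... | at-uw refl refl = ⊥-elim (not-¬ e H⁻uw)
    ... | elsewhere off₁ off₂ = trans (sym (toggleEdge-other w u H i j off₁ off₂)) e

    degree-w : degree H⁻ w + 1 ≡ degree H w
    degree-w = begin
      degree H⁻ w + 1                  ≡⟨ cong (λ b → degree H⁻ w + toℕᵇ b) (sym Hwu) ⟩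
      degree H⁻ w + toℕᵇ (H w u)       ≡⟨ sumFin-update n u _ _ unchanged ⟩
      degree H w + toℕᵇ (H⁻ w u)       ≡⟨ cong (λ b → degree H w + toℕᵇ b) H⁻wu ⟩
      degree H w + 0                   ≡⟨ +-identityʳ _ ⟩
      degree H w                       ∎
      where
      open ≡-Reasoning
      unchanged : ∀ j → u ≢ j → toℕᵇ (H⁻ w j) ≡ toℕᵇ (H w j)
      unchanged j u≢j = cong toℕᵇ (toggleEdge-other w u H w j (inj₂ (λ e → u≢j (sym e))) (inj₁ w≢u))

    degree-u : degree H⁻ u + 1 ≡ degree H u
    degree-u = begin
      degree H⁻ u + 1                  ≡⟨ cong (λ b → degree H⁻ u + toℕᵇ b) (sym Huw) ⟩
      degree H⁻ u + toℕᵇ (H u w)       ≡⟨ sumFin-update n w _ _ unchanged ⟩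
      degree H u + toℕᵇ (H⁻ u w)       ≡⟨ cong (λ b → degree H u + toℕᵇ b) H⁻uw ⟩
      degree H u + 0                   ≡⟨ +-identityʳ _ ⟩
      degree H u                       ∎
      where
      open ≡-Reasoning
      unchanged : ∀ j → w ≢ j → toℕᵇ (H⁻ u j) ≡ toℕᵇ (H u j)
      unchanged j w≢j =
        cong toℕᵇ (toggleEdge-other w u H u j (inj₁ (λ e → w≢u (sym e))) (inj₂ (λ e → w≢j (sym e))))

    degree-other : ∀ v → v ≢ w → v ≢ u → degree H⁻ v ≡ degree H v
    degree-other v v≢w v≢u = sumFin-cong n (λ z → cong toℕᵇ (toggleEdge-other w u H v z (inj₁ v≢w) (inj₁ v≢u)))

    only-neighbour : degree H⁻ w ≡ 0 → ∀ z → H w z ≡ true → z ≡ u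
    only-neighbour d≡0 z e with z Finₚ.≟ u
    ... | yes z≡u = z≡u
    ... | no z≢u = ⊥-elim (not-¬ (trans (toggleEdge-other w u H w z (inj₂ z≢u) (inj₁ w≢u)) e)
                                      (degree≡0⇒no-neighbour H⁻ w d≡0 z))

  toggleEdge-away : ∀ w u (H : Adj n) i j → i ≢ w → j ≢ w → H i j ≡ true → toggleEdge w u H i j ≡ true
  toggleEdge-away w u H i j i≢w j≢w e = trans (toggleEdge-other w u H i j (inj₁ i≢w) (inj₂ j≢w)) e

  toggleEdge-symmetric⁻¹ : ∀ w u (H : Adj n) → w ≢ u → H w u ≡ H u w →
    Symmetric (toggleEdge w u H) → Symmetric H
  toggleEdge-symmetric⁻¹ w u H w≢u Hwu≡Huw H⁻-sym i j with edgePosition w u i j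
  ... | at-wu refl refl = Hwu≡Huw
  ... | at-uw refl refl = sym Hwu≡Huw
  ... | elsewhere off₁ off₂ = trans (sym (toggleEdge-other w u H i j off₁ off₂))
    (trans (H⁻-sym i j) (toggleEdge-other w u H j i (swap off₂) (swap off₁)))

  -- A vertex whose only neighbour is u lies on no cycle: both of its cycle-neighbours would
  -- be u, contradicting injectivity since a cycle has at least three vertices.
  module _ {G : Adj n} {w u : Fin n} (only-u : ∀ z → G w z ≡ true → z ≡ u) (G-sym : Symmetric G) where

    private
      out-of-w : ∀ {a b} → G a b ≡ true → a ≡ w → b ≡ u
      out-of-w e refl = only-u _ e

      into-w : ∀ {a b} → G a b ≡ true → b ≡ w → a ≡ u
      into-w {a} e refl = only-u _ (trans (G-sym _ a) e)

      last-or-inject₁ : ∀ k (q : Fin (suc k)) → (q ≡ fromℕ k) ⊎ Σ (Fin k) λ i → inject₁ i ≡ q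
      last-or-inject₁ zero    zero    = inj₁ refl
      last-or-inject₁ (suc k) zero    = inj₂ (zero , refl)
      last-or-inject₁ (suc k) (suc q) with last-or-inject₁ k q
      ... | inj₁ e       = inj₁ (cong suc e)
      ... | inj₂ (i , e) = inj₂ (suc i , cong suc e)

      m≢2+m : ∀ (m : ℕ) → m ≢ suc (suc m)
      m≢2+m zero    ()
      m≢2+m (suc m) e = m≢2+m m (suc-injective e)

    pendant-not-on-cycle : ∀ m (c : Fin (3 + m) → Fin n) → Injective _≡_ _≡_ c →
      (∀ (i : Fin (2 + m)) → G (c (inject₁ i)) (c (suc i)) ≡ true) →
      G (c (fromℕ (2 + m))) (c zero) ≡ true →
      ∀ p → c p ≢ w
    pendant-not-on-cycle m c c-inj edges closing zero c₀≡w
      with cong toℕ (c-inj (trans (into-w closing c₀≡w) (sym (out-of-w (edges zero) c₀≡w))))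
    ... | last≡1 with trans (sym (Finₚ.toℕ-fromℕ (2 + m))) last≡1
    ...   | ()
    pendant-not-on-cycle m c c-inj edges closing (suc q) c-q≡w with last-or-inject₁ (2 + m) (suc q)
    ... | inj₁ q-last with trans (sym (Finₚ.toℕ-inject₁ q))
                             (cong toℕ (c-inj (trans (into-w (edges q) c-q≡w)
                                                     (sym (out-of-w closing (trans (cong c (sym q-last)) c-q≡w))))))
                         | suc-injective (trans (cong toℕ q-last) (Finₚ.toℕ-fromℕ (2 + m)))
    ...   | q≡0 | q≡1+m with trans (sym q≡0) q≡1+m
    ...     | ()
    pendant-not-on-cycle m c c-inj edges closing (suc q) c-q≡w | inj₂ (i , i≡q) =
      m≢2+m (toℕ q) (trans (sym (trans (cong toℕ (c-inj (trans (out-of-w (edges i) (trans (cong c i≡q) c-q≡w))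
                                                                 (sym (into-w (edges q) c-q≡w)))))
                                         (Finₚ.toℕ-inject₁ q)))
                           (cong suc (trans (sym (Finₚ.toℕ-inject₁ i)) (cong toℕ i≡q))))

  -- A walk through the pendant vertex w enters and leaves it via u, so it can be shortcut.
  reach-avoiding-pendant : ∀ {G G′ : Adj n} {w u} → (∀ z → G w z ≡ true → z ≡ u) → Symmetric G → u ≢ w →
    (∀ i j → i ≢ w → j ≢ w → G i j ≡ true → G′ i j ≡ true) →
    ∀ {x y} → Reach G x y → x ≢ w → y ≢ w → Reach G′ x y
  reach-avoiding-pendant only-u G-sym u≢w G⊆G′ here x≢w y≢w = here
  reach-avoiding-pendant {w = w} only-u G-sym u≢w G⊆G′ (step {x} {z} e r) x≢w y≢w with z Finₚ.≟ w
  ... | no z≢w = step (G⊆G′ x z x≢w z≢w e) (reach-avoiding-pendant only-u G-sym u≢w G⊆G′ r z≢w y≢w)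
  ... | yes refl with r
  ...   | here = ⊥-elim (y≢w refl)
  ...   | step {_} {z₂} e₂ r₂ with only-u z₂ e₂ | only-u x (trans (G-sym _ x) e)
  ...     | refl | refl = reach-avoiding-pendant only-u G-sym u≢w G⊆G′ r₂ u≢w y≢w

  Path : Adj n → List (Fin n) → Set
  Path G []           = ⊤
  Path G (x ∷ [])     = ⊤
  Path G (x ∷ y ∷ xs) = (G x y ≡ true) × Path G (y ∷ xs)

  data Distinct : List (Fin n) → Set where
    []  : Distinct []
    _∷_ : ∀ {x xs} → x ∉ xs → Distinct xs → Distinct (x ∷ xs)

  Distinct-head∉ : ∀ {x xs} → Distinct (x ∷ xs) → x ∉ xs
  Distinct-head∉ (x∉xs ∷ _) = x∉xs

  Distinct⇒lookup-injective : ∀ {xs} → Distinct xs → Injective _≡_ _≡_ (lookup xs)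
  Distinct⇒lookup-injective (x∉xs ∷ d) {zero}  {zero}  e = refl
  Distinct⇒lookup-injective {x ∷ xs} (x∉xs ∷ d) {zero}  {suc j} e = ⊥-elim (x∉xs (subst (_∈ xs) (sym e) (∈-lookup j)))
  Distinct⇒lookup-injective {x ∷ xs} (x∉xs ∷ d) {suc i} {zero}  e = ⊥-elim (x∉xs (subst (_∈ xs) e (∈-lookup i)))
  Distinct⇒lookup-injective (x∉xs ∷ d) {suc i} {suc j} e = cong suc (Distinct⇒lookup-injective d e)

  Distinct⇒length≤n : ∀ {xs} → Distinct xs → length xs ≤ n
  Distinct⇒length≤n {xs} d with length xs ≤? n
  ... | yes ≤n = ≤n
  ... | no ≰n with Finₚ.pigeonhole (≰⇒> ≰n) (lookup xs)
  ...   | i , j , i<j , e = ⊥-elim (Finₚ.<-irrefl (Distinct⇒lookup-injective d e) i<j)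

  Distinct-++ˡ : ∀ as bs → Distinct (as ++ bs) → Distinct as
  Distinct-++ˡ []       bs d = []
  Distinct-++ˡ (a ∷ as) bs (a∉ ∷ d) = (λ a∈as → a∉ (∈-++⁺ˡ a∈as)) ∷ Distinct-++ˡ as bs d

  Distinct-middle : ∀ as z bs → Distinct (as ++ z ∷ bs) → z ∉ as
  Distinct-middle (a ∷ as) z bs (a∉ ∷ d) (here refl) = a∉ (∈-++⁺ʳ as (here refl))
  Distinct-middle (a ∷ as) z bs (a∉ ∷ d) (there z∈as) = Distinct-middle as z bs d z∈as

  path-lookup : ∀ {G} a as → Path G (a ∷ as) → ∀ (i : Fin (length as)) →
    G (lookup (a ∷ as) (inject₁ i)) (lookup (a ∷ as) (suc i)) ≡ true
  path-lookup a (b ∷ bs) (e , p) zero    = e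
  path-lookup a (b ∷ bs) (e , p) (suc i) = path-lookup b bs p i

  path-++ˡ : ∀ {G} as bs → Path G (as ++ bs) → Path G as
  path-++ˡ []           bs p = tt
  path-++ˡ (a ∷ [])     bs p = tt
  path-++ˡ (a ∷ a′ ∷ as) bs (e , p) = e , path-++ˡ (a′ ∷ as) bs p

  path-last : ∀ {G} y ys z zs → Path G ((y ∷ ys) ++ z ∷ zs) → G (lookup (y ∷ ys) (fromℕ (length ys))) z ≡ true
  path-last y []        z zs (e , _) = e
  path-last y (y′ ∷ ys) z zs (e , p) = path-last y′ ys z zs p

  -- An edge from the start x of a simple path x y … to a later vertex z closes the cycle z x y … .
  chord⇒cycle : ∀ {G : Adj n} → Symmetric G → ∀ x y rest z →
    Path G (x ∷ y ∷ rest) → Distinct (x ∷ y ∷ rest) → G x z ≡ true → z ∈ rest → HasCycle G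
  chord⇒cycle {G} G-sym x y rest z p d Gxz z∈rest with ∈-∃++ z∈rest
  ... | ys , zs , refl = length ys , lookup cyc , Distinct⇒lookup-injective cyc-distinct , edges ,
                         path-last y ys z zs (proj₂ p)
    where
    cyc : List (Fin n)
    cyc = z ∷ x ∷ y ∷ ys
    z∉ : Distinct (x ∷ y ∷ ys ++ z ∷ zs) → z ∉ (x ∷ y ∷ ys)
    z∉ (x∉ ∷ y∉ ∷ d′) (here refl)         = x∉ (there (∈-++⁺ʳ ys (here refl)))
    z∉ (x∉ ∷ y∉ ∷ d′) (there (here refl)) = y∉ (∈-++⁺ʳ ys (here refl))
    z∉ (x∉ ∷ y∉ ∷ d′) (there (there z∈ys)) = Distinct-middle ys z zs d′ z∈ys
    cyc-distinct : Distinct cyc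
    cyc-distinct = z∉ d ∷ Distinct-++ˡ (x ∷ y ∷ ys) (z ∷ zs) d
    edges : ∀ (i : Fin (2 + length ys)) → G (lookup cyc (inject₁ i)) (lookup cyc (suc i)) ≡ true
    edges zero    = trans (G-sym z x) Gxz
    edges (suc i) = path-lookup x (y ∷ ys) (path-++ˡ (x ∷ y ∷ ys) (z ∷ zs) p) i

  record PathTo (G : Adj n) (r : Fin n) : Set where
    constructor pathTo
    field
      start next : Fin n
      rest       : List (Fin n)
      path       : Path G (start ∷ next ∷ rest)
      distinct   : Distinct (start ∷ next ∷ rest)
      ends-in-r  : r ∈ (next ∷ rest)
      reaches-r  : Reach G start r

    vertices : List (Fin n)
    vertices = start ∷ next ∷ rest

  Maximal : ∀ {G r} → PathTo G r → Set
  Maximal {G} p = ∀ z → G (PathTo.start p) z ≡ true → z ∈ PathTo.vertices p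

  extend-to-maximal : ∀ {G : Adj n} {r} → Symmetric G → (fuel : ℕ) → (p : PathTo G r) →
    n < length (PathTo.vertices p) + fuel → Σ (PathTo G r) Maximal
  extend-to-maximal G-sym zero p long =
    ⊥-elim (<⇒≱ (subst (n <_) (+-identityʳ _) long) (Distinct⇒length≤n (PathTo.distinct p)))
  extend-to-maximal {G} G-sym (suc fuel) p@(pathTo x y rest path d r∈ x↝r) long
    with Finₚ.any? (λ z → (G x z Bool.≟ true) ×-dec ¬? (z ∈? (x ∷ y ∷ rest)))
  ... | yes (z , Gxz , z∉) =
    extend-to-maximal G-sym fuel
      (pathTo z x (y ∷ rest) (Gzx , path) (z∉ ∷ d) (there r∈) (step Gzx x↝r))
      (subst (n <_) (+-suc _ fuel) long)
    where
    Gzx : G z x ≡ true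
    Gzx = trans (G-sym z x) Gxz
  ... | no none = p , maximal
    where
    maximal : ∀ z → G x z ≡ true → z ∈ (x ∷ y ∷ rest)
    maximal z Gxz with z ∈? (x ∷ y ∷ rest)
    ... | yes z∈ = z∈
    ... | no z∉  = ⊥-elim (none (z , Gxz , z∉))

-- Partial forests

module PartialForests (n t : ℕ) where

  Live : (Fin n → Bool) → Fin n → Set
  Live A v = (toℕ v < t) ⊎ (A v ≡ true)

  Live? : ∀ A v → Dec (Live A v)
  Live? A v with toℕ v <? t | A v Bool.≟ true
  ... | yes v<t | _       = yes (inj₁ v<t)
  ... | no _    | yes Av  = yes (inj₂ Av)
  ... | no v≮t  | no ¬Av  = no (λ { (inj₁ v<t) → v≮t v<t ; (inj₂ Av) → ¬Av Av })

  OnlyNonRoots : (Fin n → Bool) → Set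
  OnlyNonRoots A = ∀ v → A v ≡ true → t ≤ toℕ v

  root≢active : ∀ {A} → OnlyNonRoots A → ∀ {r w} → toℕ r < t → A w ≡ true → r ≢ w
  root≢active nonroots {r} {w} r<t Aw refl = <⇒≱ r<t (nonroots w Aw)

  -- A is the set of active (not yet peeled) non-root vertices; edges may only end in roots
  -- or active vertices, and every active vertex hangs below a root.
  record PartialForest (A : Fin n → Bool) (H : Adj n) : Set where
    field
      symmetric      : Symmetric H
      irreflexive    : ∀ i → H i i ≡ false
      acyclic        : ¬ HasCycle H
      edges-live     : ∀ i j → H i j ≡ true → Live A j
      roots-separate : FirstSeparated H t
      active-rooted  : ∀ v → A v ≡ true → Σ (Fin n) λ r → (toℕ r < t) × Reach H v r

  -- c v counts the edges at v besides the one to its parent, which active vertices still have.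
  PartialForestDeg : (Fin n → Bool) → (Fin n → ℕ) → Adj n → Set
  PartialForestDeg A c H = PartialForest A H × (∀ v → degree H v ≡ c v + toℕᵇ (A v))

  PartialForest-cong : ∀ {A} {H H′ : Adj n} → H ≗ᴬ H′ → PartialForest A H → PartialForest A H′
  PartialForest-cong {A} {H} {H′} H≗H′ F = record
    { symmetric      = λ i j → trans (sym (H≗H′ i j)) (trans (symmetric i j) (H≗H′ j i))
    ; irreflexive    = λ i → trans (sym (H≗H′ i i)) (irreflexive i)
    ; acyclic        = λ cyc → acyclic (hasCycle-mono H′⊆H cyc)
    ; edges-live     = λ i j e → edges-live i j (H′⊆H i j e)
    ; roots-separate = λ u v u<t v<t r → roots-separate u v u<t v<t (reach-mono H′⊆H r)
    ; active-rooted  = λ v Av → let (r , r<t , v↝r) = active-rooted v Av in r , r<t , reach-mono (≗ᴬ⇒⊆ᴬ H≗H′) v↝r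
    }
    where
    open PartialForest F
    H′⊆H : H′ ⊆ᴬ H
    H′⊆H = ≗ᴬ⇒⊆ᴬ (≗ᴬ-sym H≗H′)

  PartialForestDeg-cong : ∀ {A c} {H H′ : Adj n} → H ≗ᴬ H′ → PartialForestDeg A c H → PartialForestDeg A c H′
  PartialForestDeg-cong H≗H′ (F , deg-H) =
    PartialForest-cong H≗H′ F , (λ v → trans (sym (degree-cong H≗H′ v)) (deg-H v))

  active-has-neighbour : ∀ {A} {H : Adj n} → PartialForest A H → OnlyNonRoots A →
    ∀ v → A v ≡ true → Σ (Fin n) λ u → H v u ≡ true
  active-has-neighbour F nonroots v Av with PartialForest.active-rooted F v Av
  ... | r , r<t , here          = ⊥-elim (<⇒≱ r<t (nonroots v Av))
  ... | r , r<t , step {_} {z} e _ = z , e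

  deactivate : (Fin n → Bool) → Fin n → Fin n → Bool
  deactivate A w v = if v == w then false else A v

  deactivate-self : ∀ A w → deactivate A w w ≡ false
  deactivate-self A w rewrite ==-refl w = refl

  deactivate-other : ∀ A w v → v ≢ w → deactivate A w v ≡ A v
  deactivate-other A w v v≢w rewrite ==-≢ v w v≢w = refl

  deactivate⇒active : ∀ A w v → deactivate A w v ≡ true → A v ≡ true
  deactivate⇒active A w v e with v == w
  ... | false = e

  deactivate⇒≢ : ∀ A w v → deactivate A w v ≡ true → v ≢ w
  deactivate⇒≢ A w v e refl rewrite ==-refl v with e
  ... | ()

  OnlyNonRoots-deactivate : ∀ A w → OnlyNonRoots A → OnlyNonRoots (deactivate A w)
  OnlyNonRoots-deactivate A w nonroots v e = nonroots v (deactivate⇒active A w v e)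

  live⇒live-deactivate : ∀ A w v → v ≢ w → Live A v → Live (deactivate A w) v
  live⇒live-deactivate A w v v≢w (inj₁ v<t) = inj₁ v<t
  live⇒live-deactivate A w v v≢w (inj₂ Av)  = inj₂ (trans (deactivate-other A w v v≢w) Av)

  live-deactivate⇒live : ∀ A w v → Live (deactivate A w) v → Live A v
  live-deactivate⇒live A w v (inj₁ v<t) = inj₁ v<t
  live-deactivate⇒live A w v (inj₂ A′v) = inj₂ (deactivate⇒active A w v A′v)

  Parent : (Fin n → Bool) → (Fin n → ℕ) → Fin n → Fin n → Set
  Parent A c w u = (u ≢ w) × (1 ≤ c u) × Live A u

  parent? : ∀ A c w u → Dec (Parent A c w u)
  parent? A c w u = ¬? (u Finₚ.≟ w) ×-dec ((1 ≤? c u) ×-dec Live? A u)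

  ∸1+b+1≡+b : ∀ x b → 1 ≤ x → x ∸ 1 + b + 1 ≡ x + b
  ∸1+b+1≡+b (suc x) b _ = +-comm (x + b) 1

  -- The correspondence behind the recursion: an active vertex w with c w = 0 is a leaf whose
  -- parent u is live with c u ≥ 1; removing the edge {w, u} and deactivating w is reversible.
  module Leaf {A : Fin n → Bool} (nonroots : OnlyNonRoots A) {w : Fin n} (Aw : A w ≡ true)
              {u : Fin n} (w≢u : w ≢ u) {H : Adj n} (Hwu : H w u ≡ true) (Huw : H u w ≡ true)
              (H-sym : Symmetric H) (pendant : ∀ z → H w z ≡ true → z ≡ u) where

    open EdgeRemoval w≢u {H} Hwu Huw public

    A⁻ : Fin n → Bool
    A⁻ = deactivate A w

    u≢w : u ≢ w
    u≢w e = w≢u (sym e)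

    root≢w : ∀ {r} → toℕ r < t → r ≢ w
    root≢w r<t = root≢active nonroots r<t Aw

    H⊆H⁻-away : ∀ i j → i ≢ w → j ≢ w → H i j ≡ true → H⁻ i j ≡ true
    H⊆H⁻-away = toggleEdge-away w u H

    reach-H⁻ : ∀ {x y} → Reach H x y → x ≢ w → y ≢ w → Reach H⁻ x y
    reach-H⁻ = reach-avoiding-pendant pendant H-sym u≢w H⊆H⁻-away

    peel-forest : PartialForest A H → PartialForest A⁻ H⁻
    peel-forest F = record
      { symmetric      = toggleEdge-symmetric w u H w≢u symmetric
      ; irreflexive    = λ i → trans (toggleEdge-diagonal w u H w≢u i) (irreflexive i)
      ; acyclic        = λ cyc → acyclic (hasCycle-mono H⁻⊆H cyc)
      ; edges-live     = live
      ; roots-separate = λ a b a<t b<t r → roots-separate a b a<t b<t (reach-mono H⁻⊆H r)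
      ; active-rooted  = rooted
      }
      where
      open PartialForest F
      live : ∀ i j → H⁻ i j ≡ true → Live A⁻ j
      live i j e with j Finₚ.≟ w
      ... | yes refl with pendant i (trans (symmetric w i) (H⁻⊆H i w e))
      ...   | refl = ⊥-elim (not-¬ e H⁻uw)
      live i j e | no j≢w = live⇒live-deactivate A w j j≢w (edges-live i j (H⁻⊆H i j e))
      rooted : ∀ v → A⁻ v ≡ true → Σ (Fin n) λ r → (toℕ r < t) × Reach H⁻ v r
      rooted v A⁻v with active-rooted v (deactivate⇒active A w v A⁻v)
      ... | r , r<t , v↝r = r , r<t , reach-H⁻ v↝r (deactivate⇒≢ A w v A⁻v) (root≢w r<t)

    attach-forest : Live A u → PartialForest A⁻ H⁻ → PartialForest A H
    attach-forest live-u F⁻ = record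
      { symmetric      = H-sym
      ; irreflexive    = λ i → trans (sym (toggleEdge-diagonal w u H w≢u i)) (irreflexive i)
      ; acyclic        = acyclic-H
      ; edges-live     = live
      ; roots-separate = λ a b a<t b<t r → roots-separate a b a<t b<t (reach-H⁻ r (root≢w a<t) (root≢w b<t))
      ; active-rooted  = rooted
      }
      where
      open PartialForest F⁻
      acyclic-H : ¬ HasCycle H
      acyclic-H (m , c , c-inj , edges , closing) with Finₚ.any? (λ p → c p Finₚ.≟ w)
      ... | yes (p , cp≡w) = pendant-not-on-cycle pendant H-sym m c c-inj edges closing p cp≡w
      ... | no avoids-w = acyclic (m , c , c-inj , (λ i → away (edges i)) , away closing)
        where
        away : ∀ {i j} → H (c i) (c j) ≡ true → H⁻ (c i) (c j) ≡ true
        away e = H⊆H⁻-away _ _ (λ e′ → avoids-w (_ , e′)) (λ e′ → avoids-w (_ , e′)) e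
      live : ∀ i j → H i j ≡ true → Live A j
      live i j e with edgePosition w u i j
      ... | at-wu refl refl = live-u
      ... | at-uw refl refl = inj₂ Aw
      ... | elsewhere off₁ off₂ =
        live-deactivate⇒live A w j (edges-live i j (trans (toggleEdge-other w u H i j off₁ off₂) e))
      w-rooted : Live A u → Σ (Fin n) λ r → (toℕ r < t) × Reach H w r
      w-rooted (inj₁ u<t) = u , u<t , step Hwu here
      w-rooted (inj₂ Au) with active-rooted u (trans (deactivate-other A w u u≢w) Au)
      ... | r , r<t , u↝r = r , r<t , step Hwu (reach-mono H⁻⊆H u↝r)
      rooted : ∀ v → A v ≡ true → Σ (Fin n) λ r → (toℕ r < t) × Reach H v r
      rooted v Av with v Finₚ.≟ w
      ... | yes refl = w-rooted live-u
      ... | no v≢w with active-rooted v (trans (deactivate-other A w v v≢w) Av)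
      ...   | r , r<t , v↝r = r , r<t , reach-mono H⁻⊆H v↝r

    degrees-correspond : ∀ {c} → c w ≡ 0 → 1 ≤ c u → ∀ v →
      (degree H v ≡ c v + toℕᵇ (A v)) ⇔ (degree H⁻ v ≡ decrement c u v + toℕᵇ (A⁻ v))
    degrees-correspond {c} cw≡0 cu≥1 v with v Finₚ.≟ w | v Finₚ.≟ u
    ... | yes refl | _ rewrite decrement-other c u v w≢u | deactivate-self A v | cw≡0 | Aw = mk⇔
      (λ d≡1 → +-cancelʳ-≡ 1 _ _ (trans degree-w d≡1))
      (λ d⁻≡0 → trans (sym degree-w) (cong (_+ 1) d⁻≡0))
    ... | no v≢w | yes refl rewrite decrement-self c v | deactivate-other A w v v≢w = mk⇔
      (λ d≡ → +-cancelʳ-≡ 1 _ _ (trans degree-u (trans d≡ (sym (∸1+b+1≡+b (c v) _ cu≥1)))))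
      (λ d⁻≡ → trans (sym degree-u) (trans (cong (_+ 1) d⁻≡) (∸1+b+1≡+b (c v) _ cu≥1)))
    ... | no v≢w | no v≢u rewrite decrement-other c u v v≢u | deactivate-other A w v v≢w = mk⇔
      (trans (degree-other v v≢w v≢u))
      (trans (sym (degree-other v v≢w v≢u)))

  peel-leaf : ∀ {A c w u} {H : Adj n} → OnlyNonRoots A → A w ≡ true → c w ≡ 0 →
    PartialForestDeg A c H → H w u ≡ true →
    Parent A c w u × PartialForestDeg (deactivate A w) (decrement c u) (toggleEdge w u H)
  peel-leaf {A} {c} {w} {u} {H} nonroots Aw cw≡0 (F , deg-H) Hwu = (u≢w , cu≥1 , live-u) , F⁻ , deg-H⁻
    where
    open PartialForest F
    u≢w : u ≢ w
    u≢w refl = not-¬ Hwu (irreflexive u)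
    w≢u : w ≢ u
    w≢u e = u≢w (sym e)
    Huw : H u w ≡ true
    Huw = trans (symmetric u w) Hwu
    open EdgeRemoval w≢u {H} Hwu Huw using (H⁻; degree-w; degree-u; only-neighbour)
    degree-H⁻-w : degree H⁻ w ≡ 0
    degree-H⁻-w = +-cancelʳ-≡ 1 _ _ (trans degree-w (trans (deg-H w) (cong₂ _+_ cw≡0 (cong toℕᵇ Aw))))
    open Leaf nonroots Aw w≢u Hwu Huw symmetric (only-neighbour degree-H⁻-w) using (peel-forest; degrees-correspond)
    F⁻ : PartialForest (deactivate A w) H⁻
    F⁻ = peel-forest F
    live-u : Live A u
    live-u = edges-live w u Hwu
    -- A root u has no parent edge, so w counts towards c u; an active u keeps an edge in H⁻.
    cu≥1 : 1 ≤ c u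
    cu≥1 with live-u
    ... | inj₁ u<t with A u in Au
    ...   | true  = ⊥-elim (<⇒≱ u<t (nonroots u Au))
    ...   | false = ≤-trans (neighbour⇒degree≥1 H u w Huw)
                            (≤-reflexive (trans (deg-H u) (trans (cong (λ b → c u + toℕᵇ b) Au) (+-identityʳ _))))
    cu≥1 | inj₂ Au with active-has-neighbour F⁻ (OnlyNonRoots-deactivate A w nonroots) u
                          (trans (deactivate-other A w u u≢w) Au)
    ... | z , H⁻uz = ≤-trans (neighbour⇒degree≥1 H⁻ u z H⁻uz)
                             (≤-reflexive (+-cancelʳ-≡ 1 _ _ (trans degree-u (trans (deg-H u) (cong (λ b → c u + toℕᵇ b) Au)))))
    deg-H⁻ : ∀ v → degree H⁻ v ≡ decrement c u v + toℕᵇ (deactivate A w v)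
    deg-H⁻ v = Equivalence.to (degrees-correspond cw≡0 cu≥1 v) (deg-H v)

  attach-leaf : ∀ {A c w u} {H : Adj n} → OnlyNonRoots A → A w ≡ true → c w ≡ 0 →
    Parent A c w u × PartialForestDeg (deactivate A w) (decrement c u) (toggleEdge w u H) →
    PartialForestDeg A c H × H w u ≡ true
  attach-leaf {A} {c} {w} {u} {H} nonroots Aw cw≡0 ((u≢w , cu≥1 , live-u) , F⁻ , deg-H⁻) = (F , deg-H) , Hwu
    where
    open PartialForest F⁻ using (symmetric)
    w≢u : w ≢ u
    w≢u e = u≢w (sym e)
    degree-H⁻-w : degree (toggleEdge w u H) w ≡ 0
    degree-H⁻-w = trans (deg-H⁻ w)
      (cong₂ _+_ (trans (decrement-other c u w w≢u) cw≡0) (cong toℕᵇ (deactivate-self A w)))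
    H⁻wu : toggleEdge w u H w u ≡ false
    H⁻wu = degree≡0⇒no-neighbour (toggleEdge w u H) w degree-H⁻-w u
    Hwu : H w u ≡ true
    Hwu = not-injective {y = true} (trans (sym (toggleEdge-wu w u H w≢u)) H⁻wu)
    Huw : H u w ≡ true
    Huw = not-injective {y = true} (trans (sym (toggleEdge-uw w u H w≢u)) (trans (symmetric u w) H⁻wu))
    H-sym : Symmetric H
    H-sym = toggleEdge-symmetric⁻¹ w u H w≢u (trans Hwu (sym Huw)) symmetric
    open EdgeRemoval w≢u {H} Hwu Huw using (only-neighbour)
    open Leaf nonroots Aw w≢u Hwu Huw H-sym (only-neighbour degree-H⁻-w) using (attach-forest; degrees-correspond)
    F : PartialForest A H
    F = attach-forest live-u F⁻
    deg-H : ∀ v → degree H v ≡ c v + toℕᵇ (A v)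
    deg-H v = Equivalence.from (degrees-correspond cw≡0 cu≥1 v) (deg-H⁻ v)

  module _ {A : Fin n → Bool} {c : Fin n → ℕ} {w : Fin n}
           (nonroots : OnlyNonRoots A) (Aw : A w ≡ true) (cw≡0 : c w ≡ 0) where

    PartialForestDeg-via-parent : ∀ {H} u →
      (PartialForestDeg A c H × H w u ≡ true) ⇔
      (Parent A c w u × PartialForestDeg (deactivate A w) (decrement c u) (toggleEdge w u H))
    PartialForestDeg-via-parent u = mk⇔ (λ (F , Hwu) → peel-leaf nonroots Aw cw≡0 F Hwu) (attach-leaf nonroots Aw cw≡0)

    leaf-degree≡1 : ∀ {H} → PartialForestDeg A c H → degree H w ≡ 1
    leaf-degree≡1 (_ , deg-H) = trans (deg-H w) (cong₂ _+_ cw≡0 (cong toℕᵇ Aw))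

    leaf-has-neighbour : ∀ {H} → PartialForestDeg A c H → Σ (Fin n) λ u → H w u ≡ true
    leaf-has-neighbour {H} F = degree≥1⇒neighbour H w (≤-reflexive (sym (leaf-degree≡1 F)))

  PartialForestDeg-inactive : ∀ {A c} {H : Adj n} → (∀ v → A v ≡ false) →
    PartialForestDeg A c H ⇔ ((∀ i j → H i j ≡ false) × (∀ v → c v ≡ 0))
  PartialForestDeg-inactive {A} {c} {H} inactive = mk⇔ to from
    where
    to : PartialForestDeg A c H → (∀ i j → H i j ≡ false) × (∀ v → c v ≡ 0)
    to (F , deg-H) = no-edge , c≡0
      where
      open PartialForest F
      root-end : ∀ {i j} → H i j ≡ true → toℕ j < t
      root-end {i} {j} e with edges-live i j e
      ... | inj₁ j<t = j<t
      ... | inj₂ Aj  = ⊥-elim (not-¬ Aj (inactive j))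
      no-edge : ∀ i j → H i j ≡ false
      no-edge i j with H i j in e
      ... | false = refl
      ... | true with roots-separate i j (root-end (trans (symmetric j i) e)) (root-end e) (step e here)
      ...   | refl = ⊥-elim (not-¬ e (irreflexive i))
      c≡0 : ∀ v → c v ≡ 0
      c≡0 v = begin
        c v                 ≡⟨ sym (+-identityʳ _) ⟩
        c v + 0             ≡⟨ cong (λ b → c v + toℕᵇ b) (sym (inactive v)) ⟩
        c v + toℕᵇ (A v)    ≡⟨ sym (deg-H v) ⟩
        degree H v          ≡⟨ sumFin-zero n _ (λ z → cong toℕᵇ (no-edge v z)) ⟩
        0                   ∎
        where open ≡-Reasoning
    from : (∀ i j → H i j ≡ false) × (∀ v → c v ≡ 0) → PartialForestDeg A c H
    from (no-edge , c≡0) = F , deg-H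
      where
      absurd-edge : ∀ {i j} {P : Set} → H i j ≡ true → P
      absurd-edge {i} {j} e = ⊥-elim (not-¬ e (no-edge i j))
      F : PartialForest A H
      F = record
        { symmetric      = λ i j → trans (no-edge i j) (sym (no-edge j i))
        ; irreflexive    = λ i → no-edge i i
        ; acyclic        = λ { (m , c , c-inj , edges , closing) → absurd-edge closing }
        ; edges-live     = λ i j e → absurd-edge e
        ; roots-separate = λ { u v _ _ here → refl ; u v _ _ (step e _) → absurd-edge e }
        ; active-rooted  = λ v Av → ⊥-elim (not-¬ Av (inactive v))
        }
      deg-H : ∀ v → degree H v ≡ c v + toℕᵇ (A v)
      deg-H v = trans (sumFin-zero n _ (λ z → cong toℕᵇ (no-edge v z)))
                      (sym (cong₂ _+_ (c≡0 v) (cong toℕᵇ (inactive v))))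

  -- Extend a simple path starting at a root r as far as possible; its far end x is active, so
  -- a second neighbour of x lies on the path and closes a cycle.
  ¬all-active-degree≥2 : ∀ {A} {H : Adj n} → PartialForest A H → OnlyNonRoots A → ∀ v₀ → A v₀ ≡ true →
    ¬ (∀ v → A v ≡ true → 2 ≤ degree H v)
  ¬all-active-degree≥2 {A} {H} F nonroots v₀ Av₀ degrees≥2 with PartialForest.active-rooted F v₀ Av₀
  ... | r , r<t , v₀↝r with reach-sym (PartialForest.symmetric F) v₀↝r
  ...   | here = root≢active nonroots r<t Av₀ refl
  ...   | step {_} {z} Hrz _ = dead-end (extend-to-maximal symmetric n initial (m<n+m n {2} (s≤s z≤n)))
    where
    open PartialForest F
    Hzr : H z r ≡ true
    Hzr = trans (symmetric z r) Hrz
    z≢r : z ≢ r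
    z≢r refl = not-¬ Hrz (irreflexive z)
    initial : PathTo H r
    initial = pathTo z r [] (Hzr , tt) ((λ { (here z≡r) → z≢r z≡r }) ∷ (λ ()) ∷ []) (here refl) (step Hzr here)
    dead-end : Σ (PathTo H r) Maximal → ⊥
    dead-end (pathTo x y rest path d r∈ x↝r , maximal) = on-path (maximal w Hxw)
      where
      x-not-root : ¬ (toℕ x < t)
      x-not-root x<t with roots-separate x r x<t r<t x↝r
      ... | refl = Distinct-head∉ d r∈
      Ax : A x ≡ true
      Ax with edges-live y x (trans (symmetric y x) (proj₁ path))
      ... | inj₁ x<t = ⊥-elim (x-not-root x<t)
      ... | inj₂ Ax  = Ax
      second : Σ (Fin n) λ z → z ≢ y × H x z ≡ true
      second = degree≥2⇒other-neighbour H x y (degrees≥2 x Ax)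
      w : Fin n
      w = proj₁ second
      Hxw : H x w ≡ true
      Hxw = proj₂ (proj₂ second)
      on-path : w ∈ (x ∷ y ∷ rest) → ⊥
      on-path (here w≡x)          = not-¬ (subst (λ q → H x q ≡ true) w≡x Hxw) (irreflexive x)
      on-path (there (here w≡y))  = proj₁ (proj₂ second) w≡y
      on-path (there (there w∈))  = acyclic (chord⇒cycle symmetric x y rest w path d Hxw w∈)

-- Balls in bins

module Balls (n t : ℕ) where

  markerℕ : ℕ → Fin n → ℕ
  markerℕ i j = if ⌊ i ≟ toℕ j ⌋ then 1 else 0

  marker : Fin t → Fin n → ℕ
  marker R = markerℕ (toℕ R)

  -- The paper's L_j + I_j, where the indicator I_j of R = j vanishes for j ≥ t.
  occupancy : ∀ {k} → Outcome k n t → Fin n → ℕ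
  occupancy (b , R) j = load b j + marker R j

  Occupancy≡ : ∀ {k} → (Fin n → ℕ) → Outcome k n t → Set
  Occupancy≡ c o = ∀ j → occupancy o j ≡ c j

  occupancy≡? : ∀ {k} c (o : Outcome k n t) → Dec (Occupancy≡ c o)
  occupancy≡? c o = Finₚ.all? (λ j → occupancy o j ≟ c j)

  ballsMatching : ℕ → (Fin n → ℕ) → ℕ
  ballsMatching k c = sumList (outcomes k n t) (λ o → indicator (occupancy≡? c o))

  load≡sumFin : ∀ {k} (b : Fin k → Fin n) j → load b j ≡ sumFin k (λ i → toℕᵇ (b i == j))
  load≡sumFin {k} b j = trans (lsum-map≡sumList _ (allFin k)) (trans (sumList-allFin k _)
    (sumFin-cong k (λ i → trans (if-1-0≡toℕᵇ _) (cong toℕᵇ (⌊≟⌋≡== (b i) j)))))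

  load≤ : ∀ {k} (b : Fin k → Fin n) j → load b j ≤ k
  load≤ {k} b j = ≤-trans (≤-reflexive (load≡sumFin b j))
    (≤-trans (sumFin-mono k (λ i → toℕᵇ≤1 (b i == j))) (≤-reflexive (sumFin-1 k)))

  total-load : ∀ {k} (b : Fin k → Fin n) → sumFin n (load b) ≡ k
  total-load {k} b = begin
    sumFin n (load b)                                      ≡⟨ sumFin-cong n (load≡sumFin b) ⟩
    sumFin n (λ j → sumFin k (λ i → toℕᵇ (b i == j)))    ≡⟨ sumFin-swap n k (λ j i → toℕᵇ (b i == j)) ⟩
    sumFin k (λ i → sumFin n (λ j → toℕᵇ (b i == j)))    ≡⟨ sumFin-cong k (λ i → sumFin-== n (b i)) ⟩
    sumFin k (λ _ → 1)                                     ≡⟨ sumFin-1 k ⟩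
    k                                                      ∎
    where open ≡-Reasoning

  marker≤1 : ∀ R j → marker R j ≤ 1
  marker≤1 R j with toℕ R ≟ toℕ j
  ... | yes _ = ≤-refl
  ... | no _  = z≤n

  marker-nonroot : ∀ R j → t ≤ toℕ j → marker R j ≡ 0
  marker-nonroot R j t≤j with toℕ R ≟ toℕ j
  ... | yes R≡j = ⊥-elim (<⇒≱ (subst (_< t) R≡j (Finₚ.toℕ<n R)) t≤j)
  ... | no _    = refl

  occupancy-cons : ∀ {k} u (b : Fin k → Fin n) R j → occupancy (cons u b , R) j ≡ toℕᵇ (u == j) + occupancy (b , R) j
  occupancy-cons u b R j = trans (cong (_+ marker R j)
    (trans (load≡sumFin (cons u b) j) (cong (toℕᵇ (u == j) +_) (sym (load≡sumFin b j)))))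
    (+-assoc (toℕᵇ (u == j)) _ _)

  Occupancy≡-cons : ∀ {k} u (b : Fin k → Fin n) R c →
    Occupancy≡ c (cons u b , R) ⇔ ((1 ≤ c u) × Occupancy≡ (decrement c u) (b , R))
  Occupancy≡-cons u b R c = mk⇔ to from
    where
    to : Occupancy≡ c (cons u b , R) → (1 ≤ c u) × Occupancy≡ (decrement c u) (b , R)
    to occ = subst (1 ≤_) at-u (s≤s z≤n) , pointwise
      where
      at-u : suc (occupancy (b , R) u) ≡ c u
      at-u = trans (cong (λ x → toℕᵇ x + occupancy (b , R) u) (sym (==-refl u)))
                   (trans (sym (occupancy-cons u b R u)) (occ u))
      pointwise : Occupancy≡ (decrement c u) (b , R)
      pointwise j with j Finₚ.≟ u
      ... | yes refl = trans (cong (_∸ 1) at-u) (sym (decrement-self c j))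
      ... | no j≢u = trans (trans (cong (λ x → toℕᵇ x + occupancy (b , R) j) (sym (==-≢ u j (λ e → j≢u (sym e)))))
                                  (trans (sym (occupancy-cons u b R j)) (occ j)))
                           (sym (decrement-other c u j j≢u))
    from : (1 ≤ c u) × Occupancy≡ (decrement c u) (b , R) → Occupancy≡ c (cons u b , R)
    from (cu≥1 , occ) j with j Finₚ.≟ u
    ... | yes refl rewrite occupancy-cons j b R j | ==-refl j | occ j | decrement-self c j =
      trans (+-comm 1 (c j ∸ 1)) (m∸n+n≡m cu≥1)
    ... | no j≢u rewrite occupancy-cons u b R j | ==-≢ u j (λ e → j≢u (sym e)) =
      trans (occ j) (decrement-other c u j j≢u)

  -- Condition on the bin of the first ball.
  ballsMatching-suc : ∀ k c →
    ballsMatching (suc k) c ≡ sumFin n (λ u → indicator (1 ≤? c u) * ballsMatching k (decrement c u))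
  ballsMatching-suc k c = begin
    ballsMatching (suc k) c
      ≡⟨ sumList-cartesianProduct (allFuns (allFin n) (suc k)) (allFin t) _ ⟩
    sumList (allFuns (allFin n) (suc k)) (λ b → sumList (allFin t) (λ R → 𝟙 c (b , R)))
      ≡⟨ sumList-allFuns-suc (allFin n) k _ ⟩
    sumList (allFin n) (λ u → sumList (allFuns (allFin n) k) (λ b → sumList (allFin t) (λ R → 𝟙 c (cons u b , R))))
      ≡⟨ sumList-cong (allFin n) (λ u → sumList-cong (allFuns (allFin n) k) (λ b → sumList-cong (allFin t) (split u b))) ⟩
    sumList (allFin n) (λ u → sumList (allFuns (allFin n) k) (λ b → sumList (allFin t) (λ R → 𝟙₁ u * 𝟙 (decrement c u) (b , R))))
      ≡⟨ sumList-cong (allFin n) factor ⟩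
    sumList (allFin n) (λ u → 𝟙₁ u * ballsMatching k (decrement c u))
      ≡⟨ sumList-allFin n _ ⟩
    sumFin n (λ u → 𝟙₁ u * ballsMatching k (decrement c u)) ∎
    where
    open ≡-Reasoning
    𝟙 : ∀ {m} → (Fin n → ℕ) → Outcome m n t → ℕ
    𝟙 c o = indicator (occupancy≡? c o)
    𝟙₁ : Fin n → ℕ
    𝟙₁ u = indicator (1 ≤? c u)
    split : ∀ u b R → 𝟙 c (cons u b , R) ≡ 𝟙₁ u * 𝟙 (decrement c u) (b , R)
    split u b R = Indicator-≡ (indicator-spec _)
      (Indicator-× (indicator-spec (1 ≤? c u)) (indicator-spec (occupancy≡? (decrement c u) (b , R))))
      (Equivalence.to (Occupancy≡-cons u b R c)) (Equivalence.from (Occupancy≡-cons u b R c))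
    factor : ∀ u → sumList (allFuns (allFin n) k) (λ b → sumList (allFin t) (λ R → 𝟙₁ u * 𝟙 (decrement c u) (b , R)))
                 ≡ 𝟙₁ u * ballsMatching k (decrement c u)
    factor u = begin
      sumList (allFuns (allFin n) k) (λ b → sumList (allFin t) (λ R → 𝟙₁ u * 𝟙 (decrement c u) (b , R)))
        ≡⟨ sumList-cong (allFuns (allFin n) k) (λ b → sumList-*ˡ (allFin t) (𝟙₁ u) _) ⟩
      sumList (allFuns (allFin n) k) (λ b → 𝟙₁ u * sumList (allFin t) (λ R → 𝟙 (decrement c u) (b , R)))
        ≡⟨ sumList-*ˡ (allFuns (allFin n) k) (𝟙₁ u) _ ⟩
      𝟙₁ u * sumList (allFuns (allFin n) k) (λ b → sumList (allFin t) (λ R → 𝟙 (decrement c u) (b , R)))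
        ≡⟨ cong (𝟙₁ u *_) (sym (sumList-cartesianProduct (allFuns (allFin n) k) (allFin t) _)) ⟩
      𝟙₁ u * ballsMatching k (decrement c u) ∎

  ballsMatching-zero : ∀ c → ballsMatching 0 c ≡ sumFin t (λ R → indicator (Finₚ.all? (λ j → markerℕ (toℕ R) j ≟ c j)))
  ballsMatching-zero c = trans (sumList-cartesianProduct ((λ ()) ∷ []) (allFin t) _)
    (trans (+-identityʳ _) (sumList-allFin t _))

  markerℕ-self : ∀ j → markerℕ (toℕ j) j ≡ 1
  markerℕ-self j with toℕ j ≟ toℕ j
  ... | yes _ = refl
  ... | no j≢j = ⊥-elim (j≢j refl)

  markerℕ-other : ∀ u j → u ≢ j → markerℕ (toℕ u) j ≡ 0
  markerℕ-other u j u≢j with toℕ u ≟ toℕ j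
  ... | yes e = ⊥-elim (u≢j (Finₚ.toℕ-injective e))
  ... | no _  = refl

-- Counting partial forests by peeling leaves

module Counting (n t : ℕ) where

  open PartialForests n t
  open Balls n t

  size : (Fin n → Bool) → ℕ
  size A = sumFin n (λ v → toℕᵇ (A v))

  size-deactivate : ∀ A w → A w ≡ true → size (deactivate A w) + 1 ≡ size A
  size-deactivate A w Aw = begin
    size (deactivate A w) + 1                          ≡⟨ cong (λ b → size (deactivate A w) + toℕᵇ b) (sym Aw) ⟩
    size (deactivate A w) + toℕᵇ (A w)                 ≡⟨ sumFin-update n w _ _ unchanged ⟩
    size A + toℕᵇ (deactivate A w w)                   ≡⟨ cong (λ b → size A + toℕᵇ b) (deactivate-self A w) ⟩
    size A + 0                                         ≡⟨ +-identityʳ _ ⟩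
    size A                                             ∎
    where
    open ≡-Reasoning
    unchanged : ∀ v → w ≢ v → toℕᵇ (deactivate A w v) ≡ toℕᵇ (A v)
    unchanged v w≢v = cong toℕᵇ (deactivate-other A w v (λ e → w≢v (sym e)))

  size-deactivate-suc : ∀ A w s → A w ≡ true → size A ≡ suc s → size (deactivate A w) ≡ s
  size-deactivate-suc A w s Aw size≡ = +-cancelʳ-≡ 1 _ _ (trans (size-deactivate A w Aw) (trans size≡ (+-comm 1 s)))

  size≡0⇒inactive : ∀ A → size A ≡ 0 → ∀ v → A v ≡ false
  size≡0⇒inactive A size≡0 v with A v in Av
  ... | false = refl
  ... | true  = ⊥-elim (<⇒≱ (≤-trans (≤-reflexive (cong toℕᵇ (sym Av))) (term≤sumFin n _ v)) (≤-reflexive size≡0))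

  size≡suc⇒active : ∀ A s → size A ≡ suc s → Σ (Fin n) λ v → A v ≡ true
  size≡suc⇒active A s size≡ with Finₚ.any? (λ v → A v Bool.≟ true)
  ... | yes found = found
  ... | no none = ⊥-elim (0≢1+n (trans (sym (sumFin-zero n _ (λ v → cong toℕᵇ (inactive v)))) size≡))
    where
    inactive : ∀ v → A v ≡ false
    inactive v with A v in Av
    ... | true  = ⊥-elim (none (v , Av))
    ... | false = refl

  ActiveLeaf : (Fin n → Bool) → (Fin n → ℕ) → Set
  ActiveLeaf A c = Σ (Fin n) λ w → (A w ≡ true) × (c w ≡ 0)

  activeLeaf? : ∀ A c → Dec (ActiveLeaf A c)
  activeLeaf? A c = Finₚ.any? (λ v → (A v Bool.≟ true) ×-dec (c v ≟ 0))

  ¬ActiveLeaf⇒¬PartialForestDeg : ∀ {A c s} {H : Adj n} → size A ≡ suc s → OnlyNonRoots A →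
    ¬ ActiveLeaf A c → ¬ PartialForestDeg A c H
  ¬ActiveLeaf⇒¬PartialForestDeg {A} {c} {s} {H} size≡ nonroots no-leaf (F , deg-H) =
    ¬all-active-degree≥2 F nonroots v₀ Av₀ degrees≥2
    where
    v₀ : Fin n
    v₀ = proj₁ (size≡suc⇒active A s size≡)
    Av₀ : A v₀ ≡ true
    Av₀ = proj₂ (size≡suc⇒active A s size≡)
    degrees≥2 : ∀ v → A v ≡ true → 2 ≤ degree H v
    degrees≥2 v Av with c v in cv
    ... | zero  = ⊥-elim (no-leaf (v , Av , cv))
    ... | suc k = subst (2 ≤_) (sym (trans (deg-H v) (cong₂ _+_ cv (cong toℕᵇ Av))))
                        (subst (2 ≤_) (+-comm 1 (suc k)) (s≤s (s≤s z≤n)))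

  partialForestDeg? : ∀ s A → size A ≡ s → OnlyNonRoots A → ∀ c H → Dec (PartialForestDeg A c H)
  partialForestDeg? zero A size≡0 nonroots c H =
    map′ (Equivalence.from equiv) (Equivalence.to equiv)
      (Finₚ.all? (λ i → Finₚ.all? (λ j → H i j Bool.≟ false)) ×-dec Finₚ.all? (λ v → c v ≟ 0))
    where
    equiv : PartialForestDeg A c H ⇔ ((∀ i j → H i j ≡ false) × (∀ v → c v ≡ 0))
    equiv = PartialForestDeg-inactive (size≡0⇒inactive A size≡0)
  partialForestDeg? (suc s) A size≡ nonroots c H with activeLeaf? A c
  ... | no no-leaf = no (¬ActiveLeaf⇒¬PartialForestDeg size≡ nonroots no-leaf)
  ... | yes (w , Aw , cw≡0) =
    map′ from to (Finₚ.any? (λ u → (H w u Bool.≟ true) ×-dec (parent? A c w u ×-dec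
      partialForestDeg? s (deactivate A w) (size-deactivate-suc A w s Aw size≡)
        (OnlyNonRoots-deactivate A w nonroots) (decrement c u) (toggleEdge w u H))))
    where
    via : ∀ u → (PartialForestDeg A c H × H w u ≡ true) ⇔
                (Parent A c w u × PartialForestDeg (deactivate A w) (decrement c u) (toggleEdge w u H))
    via = PartialForestDeg-via-parent nonroots Aw cw≡0
    from : (Σ (Fin n) λ u → H w u ≡ true × Parent A c w u ×
             PartialForestDeg (deactivate A w) (decrement c u) (toggleEdge w u H)) → PartialForestDeg A c H
    from (u , _ , parent , F⁻) = proj₁ (Equivalence.from (via u) (parent , F⁻))
    to : PartialForestDeg A c H → (Σ (Fin n) λ u → H w u ≡ true × Parent A c w u ×
           PartialForestDeg (deactivate A w) (decrement c u) (toggleEdge w u H))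
    to F with leaf-has-neighbour nonroots Aw cw≡0 F
    ... | u , Hwu = u , Hwu , Equivalence.to (via u) (F , Hwu)

  Counts : (Fin n → Bool) → (Fin n → ℕ) → (Adj n → ℕ) → Set
  Counts A c φ = ∀ H → Indicator (PartialForestDeg A c H) (φ H)

  Counts-cong : ∀ {A c φ} → Counts A c φ → φ Preserves _≗ᴬ_ ⟶ _≡_
  Counts-cong 𝟙F {H} {H′} H≗H′ =
    Indicator-≡ (𝟙F H) (𝟙F H′) (PartialForestDeg-cong H≗H′) (PartialForestDeg-cong (≗ᴬ-sym H≗H′))

  -- Sort the forests by the parent u of the leaf w and remove the edge {w, u}.
  count-by-parent : ∀ {A c w} → OnlyNonRoots A → A w ≡ true → c w ≡ 0 →
    ∀ (φ : Adj n → ℕ) → Counts A c φ →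
    ∀ (ψ : Fin n → Adj n → ℕ) → (∀ u → Counts (deactivate A w) (decrement c u) (ψ u)) →
    sumList (allAdj n) φ ≡ sumFin n (λ u → indicator (parent? A c w u) * sumList (allAdj n) (ψ u))
  count-by-parent {A} {c} {w} nonroots Aw cw≡0 φ 𝟙F ψ 𝟙F⁻ = begin
    sumList (allAdj n) φ
      ≡⟨ sumList-cong (allAdj n) (λ H → split H (𝟙F H)) ⟩
    sumList (allAdj n) (λ H → sumFin n (λ u → φ H * toℕᵇ (H w u)))
      ≡⟨ sumList-cong (allAdj n) (λ H → sym (sumList-allFin n _)) ⟩
    sumList (allAdj n) (λ H → sumList (allFin n) (λ u → φ H * toℕᵇ (H w u)))
      ≡⟨ sumList-swap (allAdj n) (allFin n) _ ⟩
    sumList (allFin n) (λ u → sumList (allAdj n) (λ H → φ H * toℕᵇ (H w u)))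
      ≡⟨ sumList-allFin n _ ⟩
    sumFin n (λ u → sumList (allAdj n) (λ H → φ H * toℕᵇ (H w u)))
      ≡⟨ sumFin-cong n (λ u → sumList-cong (allAdj n) (remove-edge u)) ⟩
    sumFin n (λ u → sumList (allAdj n) (λ H → 𝟙parent u * ψ u (toggleEdge w u H)))
      ≡⟨ sumFin-cong n (λ u → sumList-*ˡ (allAdj n) (𝟙parent u) _) ⟩
    sumFin n (λ u → 𝟙parent u * sumList (allAdj n) (λ H → ψ u (toggleEdge w u H)))
      ≡⟨ sumFin-cong n (λ u → cong (𝟙parent u *_) (sumList-allAdj-toggleEdge w u (ψ u) (Counts-cong (𝟙F⁻ u)))) ⟩
    sumFin n (λ u → 𝟙parent u * sumList (allAdj n) (ψ u)) ∎
    where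
    open ≡-Reasoning
    𝟙parent : Fin n → ℕ
    𝟙parent u = indicator (parent? A c w u)
    split : ∀ H {x} → Indicator (PartialForestDeg A c H) x → x ≡ sumFin n (λ u → x * toℕᵇ (H w u))
    split H (holds F) = sym (trans (sumFin-cong n (λ u → *-identityˡ _)) (leaf-degree≡1 nonroots Aw cw≡0 F))
    split H (fails _) = sym (sumFin-zero n _ (λ _ → refl))
    remove-edge : ∀ u H → φ H * toℕᵇ (H w u) ≡ 𝟙parent u * ψ u (toggleEdge w u H)
    remove-edge u H = Indicator-≡ (Indicator-× (𝟙F H) (Indicator-toℕᵇ (H w u)))
      (Indicator-× (indicator-spec (parent? A c w u)) (𝟙F⁻ u (toggleEdge w u H)))
      (Equivalence.to (PartialForestDeg-via-parent nonroots Aw cw≡0 u))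
      (Equivalence.from (PartialForestDeg-via-parent nonroots Aw cw≡0 u))

  count-inactive : ∀ {A c φ} → (∀ v → A v ≡ false) → Counts A c φ →
    sumList (allAdj n) φ ≡ indicator (Finₚ.all? (λ v → c v ≟ 0))
  count-inactive {A} {c} {φ} inactive 𝟙F = begin
    sumList (allAdj n) φ                        ≡⟨ sumList-cong (allAdj n) empty-and-zero ⟩
    sumList (allAdj n) (λ H → 𝟙c * δ H)         ≡⟨ sumList-*ˡ (allAdj n) 𝟙c δ ⟩
    𝟙c * sumList (allAdj n) δ                   ≡⟨ cong (𝟙c *_) (sumList-allAdj-δ {n} (λ _ _ → false)) ⟩
    𝟙c * 1                                      ≡⟨ *-identityʳ 𝟙c ⟩
    𝟙c                                          ∎
    where
    open ≡-Reasoning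
    𝟙c : ℕ
    𝟙c = indicator (Finₚ.all? (λ v → c v ≟ 0))
    δ : Adj n → ℕ
    δ H = prodFin n (λ i → prodFin n (λ j → indicator (H i j Bool.≟ false)))
    empty-and-zero : ∀ H → φ H ≡ 𝟙c * δ H
    empty-and-zero H = Indicator-≡ (𝟙F H)
      (Indicator-× (indicator-spec (Finₚ.all? (λ v → c v ≟ 0)))
                   (Indicator-∀ n _ (λ i → Indicator-∀ n _ (λ j → indicator-spec (H i j Bool.≟ false)))))
      (λ F → let (no-edge , c≡0) = Equivalence.to (PartialForestDeg-inactive inactive) F in c≡0 , no-edge)
      (λ (c≡0 , no-edge) → Equivalence.from (PartialForestDeg-inactive inactive) (no-edge , c≡0))

  -- Every active vertex needs a ball, but there are fewer balls than active vertices.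
  ¬ActiveLeaf⇒ballsMatching≡0 : ∀ s A c → size A ≡ suc s → OnlyNonRoots A → ¬ ActiveLeaf A c → ballsMatching s c ≡ 0
  ¬ActiveLeaf⇒ballsMatching≡0 s A c size≡ nonroots no-leaf = sumList-zero (outcomes s n t) _ none
    where
    none : ∀ o → indicator (occupancy≡? c o) ≡ 0
    none (b , R) = Indicator-fails (indicator-spec (occupancy≡? c (b , R))) λ occ →
      <⇒≱ (s≤s ≤-refl) (subst₂ _≤_ size≡ (total-load b) (sumFin-mono n (active≤load occ)))
      where
      active≤load : Occupancy≡ c (b , R) → ∀ j → toℕᵇ (A j) ≤ load b j
      active≤load occ j with A j in Aj
      ... | false = z≤n
      ... | true with c j in cj
      ...   | zero  = ⊥-elim (no-leaf (j , Aj , cj))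
      ...   | suc _ = subst (1 ≤_) (sym (trans load≡ cj)) (s≤s z≤n)
        where
        load≡ : load b j ≡ c j
        load≡ = trans (sym (+-identityʳ _))
                      (trans (cong (load b j +_) (sym (marker-nonroot R j (nonroots j Aj)))) (occ j))

  SupportedOnLive : (Fin n → Bool) → (Fin n → ℕ) → Set
  SupportedOnLive A c = ∀ v → ¬ Live A v → c v ≡ 0

  SupportedOnLive-deactivate : ∀ {A c w} → c w ≡ 0 → SupportedOnLive A c → SupportedOnLive (deactivate A w) c
  SupportedOnLive-deactivate {A} {c} {w} cw≡0 supported v dead with v Finₚ.≟ w
  ... | yes refl = cw≡0
  ... | no v≢w   = supported v (λ live → dead (live⇒live-deactivate A w v v≢w live))

  SupportedOnLive-decrement : ∀ {A c} → SupportedOnLive A c → ∀ u → SupportedOnLive A (decrement c u)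
  SupportedOnLive-decrement {A} {c} supported u v dead with v Finₚ.≟ u
  ... | yes refl = trans (decrement-self c v) (cong (_∸ 1) (supported v dead))
  ... | no v≢u   = trans (decrement-other c u v v≢u) (supported v dead)

  Parent⇔positive : ∀ {A c w} → c w ≡ 0 → SupportedOnLive A c → ∀ u → Parent A c w u ⇔ (1 ≤ c u)
  Parent⇔positive {A} {c} {w} cw≡0 supported u = mk⇔ (λ (_ , cu≥1 , _) → cu≥1)
    (λ cu≥1 → (λ { refl → <⇒≱ cu≥1 (≤-reflexive cw≡0) }) , cu≥1 , live cu≥1)
    where
    live : 1 ≤ c u → Live A u
    live cu≥1 with Live? A u
    ... | yes live-u = live-u
    ... | no dead    = ⊥-elim (<⇒≱ cu≥1 (≤-reflexive (supported u dead)))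

  last-leaf-parent : ∀ {A c w} → OnlyNonRoots A → A w ≡ true → (∀ v → deactivate A w v ≡ false) → ∀ u →
    (Parent A c w u × (∀ v → decrement c u v ≡ 0)) ⇔ ((toℕ u < t) × (∀ j → markerℕ (toℕ u) j ≡ c j))
  last-leaf-parent {A} {c} {w} nonroots Aw A⁻-inactive u = mk⇔ to from
    where
    to : Parent A c w u × (∀ v → decrement c u v ≡ 0) → (toℕ u < t) × (∀ j → markerℕ (toℕ u) j ≡ c j)
    to ((u≢w , cu≥1 , live-u) , exhausted) = root live-u , unit
      where
      root : Live A u → toℕ u < t
      root (inj₁ u<t) = u<t
      root (inj₂ Au)  = ⊥-elim (not-¬ (trans (deactivate-other A w u u≢w) Au) (A⁻-inactive u))
      unit : ∀ j → markerℕ (toℕ u) j ≡ c j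
      unit j with j Finₚ.≟ u
      ... | yes refl = trans (markerℕ-self j) (sym (m∸1≡0⇒m≡1 (c j) cu≥1 (trans (sym (decrement-self c j)) (exhausted j))))
        where
        m∸1≡0⇒m≡1 : ∀ m → 1 ≤ m → m ∸ 1 ≡ 0 → m ≡ 1
        m∸1≡0⇒m≡1 (suc zero) _ _ = refl
      ... | no j≢u = trans (markerℕ-other u j (λ e → j≢u (sym e))) (sym (trans (sym (decrement-other c u j j≢u)) (exhausted j)))
    from : (toℕ u < t) × (∀ j → markerℕ (toℕ u) j ≡ c j) → Parent A c w u × (∀ v → decrement c u v ≡ 0)
    from (u<t , unit) = (root≢active nonroots u<t Aw , subst (1 ≤_) cu≡1 (s≤s z≤n) , inj₁ u<t) , exhausted
      where
      cu≡1 : 1 ≡ c u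
      cu≡1 = trans (sym (markerℕ-self u)) (unit u)
      exhausted : ∀ v → decrement c u v ≡ 0
      exhausted v with v Finₚ.≟ u
      ... | yes refl = trans (decrement-self c v) (cong (_∸ 1) (sym cu≡1))
      ... | no v≢u   = trans (decrement-other c u v v≢u) (trans (sym (unit v)) (markerℕ-other u v (λ e → v≢u (sym e))))

  partialForests≡balls-last : ∀ {A c w} → OnlyNonRoots A → A w ≡ true → size (deactivate A w) ≡ 0 →
    ∀ (ψ : Fin n → Adj n → ℕ) → (∀ u → Counts (deactivate A w) (decrement c u) (ψ u)) →
    sumFin n (λ u → indicator (parent? A c w u) * sumList (allAdj n) (ψ u)) ≡ ballsMatching 0 c
  partialForests≡balls-last {A} {c} {w} nonroots Aw size⁻ ψ 𝟙ψ = begin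
    sumFin n (λ u → indicator (parent? A c w u) * sumList (allAdj n) (ψ u))
      ≡⟨ sumFin-cong n root-parent ⟩
    sumFin n (λ u → indicator (toℕ u <? t) * δ (toℕ u))
      ≡⟨ sumFin-prefix δ t≤n ⟩
    sumFin t (λ R → δ (toℕ R))
      ≡⟨ sym (ballsMatching-zero c) ⟩
    ballsMatching 0 c ∎
    where
    open ≡-Reasoning
    inactive : ∀ v → deactivate A w v ≡ false
    inactive = size≡0⇒inactive (deactivate A w) size⁻
    δ : ℕ → ℕ
    δ i = indicator (Finₚ.all? (λ j → markerℕ i j ≟ c j))
    t≤n : t ≤ n
    t≤n = ≤-trans (nonroots w Aw) (<⇒≤ (Finₚ.toℕ<n w))
    root-parent : ∀ u → indicator (parent? A c w u) * sumList (allAdj n) (ψ u) ≡ indicator (toℕ u <? t) * δ (toℕ u)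
    root-parent u = trans (cong (indicator (parent? A c w u) *_) (count-inactive inactive (𝟙ψ u)))
      (Indicator-≡ (Indicator-× (indicator-spec (parent? A c w u)) (indicator-spec (Finₚ.all? (λ v → decrement c u v ≟ 0))))
                   (Indicator-× (indicator-spec (toℕ u <? t)) (indicator-spec (Finₚ.all? (λ j → markerℕ (toℕ u) j ≟ c j))))
        (Equivalence.to (last-leaf-parent nonroots Aw inactive u))
        (Equivalence.from (last-leaf-parent nonroots Aw inactive u)))

  partialForests≡balls : ∀ s A → size A ≡ suc s → OnlyNonRoots A → ∀ c → SupportedOnLive A c →
    ∀ (φ : Adj n → ℕ) → Counts A c φ → sumList (allAdj n) φ ≡ ballsMatching s c
  partialForests≡balls s A size≡ nonroots c supported φ 𝟙F with activeLeaf? A c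
  ... | no no-leaf = trans
    (sumList-zero (allAdj n) φ (λ H → Indicator-fails (𝟙F H) (¬ActiveLeaf⇒¬PartialForestDeg size≡ nonroots no-leaf)))
    (sym (¬ActiveLeaf⇒ballsMatching≡0 s A c size≡ nonroots no-leaf))
  ... | yes (w , Aw , cw≡0) = trans (count-by-parent nonroots Aw cw≡0 φ 𝟙F ψ 𝟙ψ) (by-parent s refl)
    where
    A⁻ : Fin n → Bool
    A⁻ = deactivate A w
    size⁻ : size A⁻ ≡ s
    size⁻ = size-deactivate-suc A w s Aw size≡
    nonroots⁻ : OnlyNonRoots A⁻
    nonroots⁻ = OnlyNonRoots-deactivate A w nonroots
    ψ : Fin n → Adj n → ℕ
    ψ u H = indicator (partialForestDeg? s A⁻ size⁻ nonroots⁻ (decrement c u) H)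
    𝟙ψ : ∀ u → Counts A⁻ (decrement c u) (ψ u)
    𝟙ψ u H = indicator-spec _
    by-parent : ∀ s′ → s′ ≡ s →
      sumFin n (λ u → indicator (parent? A c w u) * sumList (allAdj n) (ψ u)) ≡ ballsMatching s c
    by-parent (suc s′) refl = trans (sumFin-cong n recurse) (sym (ballsMatching-suc s′ c))
      where
      recurse : ∀ u → indicator (parent? A c w u) * sumList (allAdj n) (ψ u)
                      ≡ indicator (1 ≤? c u) * ballsMatching s′ (decrement c u)
      recurse u = cong₂ _*_
        (Indicator-≡ (indicator-spec (parent? A c w u)) (indicator-spec (1 ≤? c u))
          (Equivalence.to (Parent⇔positive cw≡0 supported u)) (Equivalence.from (Parent⇔positive cw≡0 supported u)))
        (partialForests≡balls s′ A⁻ size⁻ nonroots⁻ (decrement c u)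
          (SupportedOnLive-decrement (SupportedOnLive-deactivate cw≡0 supported) u) (ψ u) (𝟙ψ u))
    by-parent zero refl = partialForests≡balls-last nonroots Aw size⁻ ψ 𝟙ψ

-- Forests with separated roots

module Forests (n t : ℕ) where

  open PartialForests n t
  open Balls n t
  open Counting n t

  nonRoot : Fin n → Bool
  nonRoot v = if ⌊ toℕ v <? t ⌋ then false else true

  nonRoot-nonroot : ∀ v → ¬ (toℕ v < t) → nonRoot v ≡ true
  nonRoot-nonroot v v≮t with toℕ v <? t
  ... | yes v<t = ⊥-elim (v≮t v<t)
  ... | no _    = refl

  onlyNonRoots : OnlyNonRoots nonRoot
  onlyNonRoots v _ with toℕ v <? t
  ... | no v≮t = ≮⇒≥ v≮t

  all-live : ∀ v → Live nonRoot v
  all-live v with toℕ v <? t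
  ... | yes v<t = inj₁ v<t
  ... | no _    = inj₂ refl

  size-nonRoot : t ≤ n → size nonRoot + t ≡ n
  size-nonRoot t≤n = begin
    size nonRoot + t                                                   ≡⟨ cong (size nonRoot +_) roots ⟩
    size nonRoot + sumFin n (λ u → indicator (toℕ u <? t) * 1)         ≡⟨ sym (sumFin-+ n _ _) ⟩
    sumFin n (λ u → toℕᵇ (nonRoot u) + indicator (toℕ u <? t) * 1)     ≡⟨ sumFin-cong n one-each ⟩
    sumFin n (λ _ → 1)                                                 ≡⟨ sumFin-1 n ⟩
    n                                                                  ∎
    where
    open ≡-Reasoning
    roots : t ≡ sumFin n (λ u → indicator (toℕ u <? t) * 1)
    roots = sym (trans (sumFin-prefix (λ _ → 1) t≤n) (sumFin-1 t))
    one-each : ∀ u → toℕᵇ (nonRoot u) + indicator (toℕ u <? t) * 1 ≡ 1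
    one-each u with toℕ u <? t
    ... | yes _ = refl
    ... | no _  = refl

  module _ (t≤n : t ≤ n) where

    root : Fin t → Fin n
    root j = inject≤ j t≤n

    root<t : ∀ j → toℕ (root j) < t
    root<t j = subst (_< t) (sym (Finₚ.toℕ-inject≤ j t≤n)) (Finₚ.toℕ<n j)

    root-fromℕ< : ∀ v (v<t : toℕ v < t) → root (fromℕ< v<t) ≡ v
    root-fromℕ< v v<t = Finₚ.toℕ-injective (trans (Finₚ.toℕ-inject≤ _ t≤n) (Finₚ.toℕ-fromℕ< v<t))

    -- The t roots lie in distinct components and there are only t components, so (an injective
    -- self-map of Fin t being onto) every component contains a root.
    inF⇔partialForest : ∀ H → InF n t H ⇔ PartialForest nonRoot H
    inF⇔partialForest H = mk⇔ to from
      where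
      to : InF n t H → PartialForest nonRoot H
      to (((H-sym , H-irr) , H-acyc) , (rep , _ , covered) , separated) = record
        { symmetric = H-sym ; irreflexive = H-irr ; acyclic = H-acyc
        ; edges-live = λ _ j _ → all-live j ; roots-separate = separated ; active-rooted = rooted }
        where
        component : Fin t → Fin t
        component j = proj₁ (covered (root j))
        component-inj : Injective _≡_ _≡_ component
        component-inj {j} {j′} e = Finₚ.inject≤-injective t≤n t≤n j j′
          (separated (root j) (root j′) (root<t j) (root<t j′) (reach-trans (proj₂ (covered (root j)))
            (subst (λ z → Reach H (rep z) (root j′)) (sym e) (reach-sym H-sym (proj₂ (covered (root j′)))))))
        rooted : ∀ v → nonRoot v ≡ true → Σ (Fin n) λ r → (toℕ r < t) × Reach H v r
        rooted v _ with covered v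
        ... | i , v↝i with injective⇒surjective component component-inj i
        ...   | j , e = root j , root<t j ,
                        reach-trans v↝i (subst (λ z → Reach H (rep z) (root j)) e (reach-sym H-sym (proj₂ (covered (root j)))))
      from : PartialForest nonRoot H → InF n t H
      from F = ((symmetric , irreflexive) , acyclic) , (root , separate , covered) , roots-separate
        where
        open PartialForest F
        separate : ∀ i j → Reach H (root i) (root j) → i ≡ j
        separate i j r = Finₚ.inject≤-injective t≤n t≤n i j (roots-separate (root i) (root j) (root<t i) (root<t j) r)
        covered : ∀ v → Σ (Fin t) λ i → Reach H v (root i)
        covered v with toℕ v <? t
        ... | yes v<t = fromℕ< v<t , subst (Reach H v) (sym (root-fromℕ< v v<t)) here
        ... | no v≮t with active-rooted v (nonRoot-nonroot v v≮t)
        ...   | r , r<t , v↝r = fromℕ< r<t , subst (Reach H v) (sym (root-fromℕ< r r<t)) v↝r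

  ballVec≡occupancy+nonRoot : ∀ {k} (o : Outcome k n t) v → ballVec o v ≡ occupancy o v + toℕᵇ (nonRoot v)
  ballVec≡occupancy+nonRoot (b , R) v with toℕ v <? t
  ... | yes _   = sym (+-identityʳ _)
  ... | no v≮t  = cong (_+ 1) (sym (trans (cong (load b v +_) (marker-nonroot R v (≮⇒≥ v≮t))) (+-identityʳ _)))

  -- Degree and occupancy functions take values ≤ n, so each occurs exactly once here.
  candidates : List (Fin n → ℕ)
  candidates = allFuns (upTo (suc n)) n

  sumList-allFuns-upTo-δ : ∀ (g : Fin n → ℕ) → (∀ v → g v ≤ n) →
    sumList candidates (λ c → prodFin n (λ v → indicator (c v ≟ g v))) ≡ 1
  sumList-allFuns-upTo-δ g g≤n = sumList-allFuns-δ (λ x y → indicator (x ≟ y)) (_≤ n) (upTo (suc n))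
    (λ y y≤n → trans (sumList-applyUpTo (suc n) (λ i → i) (λ x → indicator (x ≟ y))) (sumℕ-δ (suc n) y (s≤s y≤n)))
    n g g≤n

  sum-over-candidates : ∀ (g : Fin n → ℕ) → (∀ v → g v ≤ n) → ∀ {Q : Set} {x} → Indicator Q x →
    ∀ (φ : (Fin n → ℕ) → ℕ) → (∀ c → Indicator (Q × (∀ v → c v ≡ g v)) (φ c)) →
    sumList candidates φ ≡ x
  sum-over-candidates g g≤n {Q} {x} 𝟙Q φ 𝟙φ = begin
    sumList candidates φ                              ≡⟨ sumList-cong candidates split ⟩
    sumList candidates (λ c → x * δ c)                ≡⟨ sumList-*ˡ candidates x δ ⟩
    x * sumList candidates δ                          ≡⟨ cong (x *_) (sumList-allFuns-upTo-δ g g≤n) ⟩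
    x * 1                                             ≡⟨ *-identityʳ x ⟩
    x                                                 ∎
    where
    open ≡-Reasoning
    δ : (Fin n → ℕ) → ℕ
    δ c = prodFin n (λ v → indicator (c v ≟ g v))
    split : ∀ c → φ c ≡ x * δ c
    split c = Indicator-≡ (𝟙φ c) (Indicator-× 𝟙Q (Indicator-∀ n _ (λ v → indicator-spec (c v ≟ g v))))
      (λ q → q) (λ q → q)

  module _ (t<n : t < n) where

    private
      t≤n : t ≤ n
      t≤n = <⇒≤ t<n

    m : ℕ
    m = n ∸ t ∸ 1

    1+m≡n∸t : suc m ≡ n ∸ t
    1+m≡n∸t = trans (+-comm 1 m) (m∸n+n≡m (m<n⇒0<n∸m t<n))

    size-nonRoot≡ : size nonRoot ≡ suc m
    size-nonRoot≡ = trans (sym (m+n∸n≡m (size nonRoot) t)) (trans (cong (_∸ t) (size-nonRoot t≤n)) (sym 1+m≡n∸t))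

    forestDeg? : ∀ c H → Dec (PartialForestDeg nonRoot c H)
    forestDeg? = partialForestDeg? (suc m) nonRoot size-nonRoot≡ onlyNonRoots

    forests≡balls : ∀ c (φ : Adj n → ℕ) → Counts nonRoot c φ → sumList (allAdj n) φ ≡ ballsMatching m c
    forests≡balls c = partialForests≡balls m nonRoot size-nonRoot≡ onlyNonRoots c (λ v dead → ⊥-elim (dead (all-live v)))

    residual : Adj n → Fin n → ℕ
    residual H v = degree H v ∸ toℕᵇ (nonRoot v)

    nonRoot≤degree : ∀ {H} → PartialForest nonRoot H → ∀ v → toℕᵇ (nonRoot v) ≤ degree H v
    nonRoot≤degree {H} F v with nonRoot v in nonroot-v
    ... | false = z≤n
    ... | true  = let (u , Hvu) = active-has-neighbour F onlyNonRoots v nonroot-v in neighbour⇒degree≥1 H v u Hvu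

    PartialForestDeg⇔residual : ∀ c H →
      PartialForestDeg nonRoot c H ⇔ (PartialForest nonRoot H × (∀ v → c v ≡ residual H v))
    PartialForestDeg⇔residual c H = mk⇔
      (λ (F , deg-H) → F , (λ v → sym (trans (cong (_∸ toℕᵇ (nonRoot v)) (deg-H v)) (m+n∸n≡m (c v) (toℕᵇ (nonRoot v))))))
      (λ (F , c≗) → F , (λ v → trans (sym (m∸n+n≡m (nonRoot≤degree F v))) (cong (_+ toℕᵇ (nonRoot v)) (sym (c≗ v)))))

    inF? : ∀ H → Dec (InF n t H)
    inF? H = map′ (Equivalence.from (inF⇔partialForest t≤n H)) (Equivalence.to (inF⇔partialForest t≤n H))
      (map′ proj₁ (λ F → Equivalence.from (PartialForestDeg⇔residual (residual H) H) (F , λ _ → refl))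
        (forestDeg? (residual H) H))

    occupancy≤n : ∀ (o : Outcome m n t) v → occupancy o v ≤ n
    occupancy≤n (b , R) v = ≤-trans (+-mono-≤ (load≤ b v) (marker≤1 R v))
      (≤-trans (≤-reflexive (trans (+-comm m 1) 1+m≡n∸t)) (m∸n≤m n t))

    inF-by-residual : ∀ H → indicator (inF? H) ≡ sumList candidates (λ c → indicator (forestDeg? c H))
    inF-by-residual H = sym (sum-over-candidates (residual H) residual≤n (indicator-spec (inF? H)) _
      (λ c → Indicator-⇔ (indicator-spec (forestDeg? c H))
        (λ F → let (F′ , c≗) = Equivalence.to (PartialForestDeg⇔residual c H) F
               in Equivalence.from (inF⇔partialForest t≤n H) F′ , c≗)
        (λ (I , c≗) → Equivalence.from (PartialForestDeg⇔residual c H) (Equivalence.to (inF⇔partialForest t≤n H) I , c≗))))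
      where
      residual≤n : ∀ v → residual H v ≤ n
      residual≤n v = ≤-trans (m∸n≤m (degree H v) (toℕᵇ (nonRoot v))) (degree≤n H v)

    occupancy-unique : ∀ o → sumList candidates (λ c → indicator (occupancy≡? c o)) ≡ 1
    occupancy-unique o = sum-over-candidates (occupancy o) (occupancy≤n o) (holds tt) _
      (λ c → Indicator-⇔ (indicator-spec (occupancy≡? c o)) (λ occ → tt , (λ v → sym (occ v))) (λ (_ , c≗) v → sym (c≗ v)))

    -- Sort forests by their residual degrees c and outcomes by their occupancy c.
    forests≡outcomes : ∀ {N} → Count (InF n t) (allAdj n) N → N ≡ length (outcomes m n t)
    forests≡outcomes {N} count = begin
      N
        ≡⟨ count≡sumList _ count (λ H → indicator-spec (inF? H)) ⟩
      sumList (allAdj n) (λ H → indicator (inF? H))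
        ≡⟨ sumList-cong (allAdj n) inF-by-residual ⟩
      sumList (allAdj n) (λ H → sumList candidates (λ c → 𝟙F c H))
        ≡⟨ sumList-swap (allAdj n) candidates (λ H c → 𝟙F c H) ⟩
      sumList candidates (λ c → sumList (allAdj n) (𝟙F c))
        ≡⟨ sumList-cong candidates (λ c → forests≡balls c (𝟙F c) (λ H → indicator-spec (forestDeg? c H))) ⟩
      sumList candidates (λ c → ballsMatching m c)
        ≡⟨ sumList-swap candidates outs (λ c o → indicator (occupancy≡? c o)) ⟩
      sumList outs (λ o → sumList candidates (λ c → indicator (occupancy≡? c o)))
        ≡⟨ sumList-cong outs occupancy-unique ⟩
      sumList outs (λ _ → 1)
        ≡⟨ sumList-1≡length outs ⟩
      length outs ∎
      where
      open ≡-Reasoning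
      outs : List (Outcome m n t)
      outs = outcomes m n t
      𝟙F : (Fin n → ℕ) → Adj n → ℕ
      𝟙F c H = indicator (forestDeg? c H)

    module _ (d : Fin n → ℕ) where

      forests-of-degree≡balls : ∀ c → (∀ v → d v ≡ c v + toℕᵇ (nonRoot v)) →
        ∀ {kF} → Count (λ G → InF n t G × DegSeq G d) (allAdj n) kF → kF ≡ ballsMatching m c
      forests-of-degree≡balls c d≡ count =
        trans (count≡sumList _ count 𝟙F) (forests≡balls c _ (λ H → indicator-spec (forestDeg? c H)))
        where
        𝟙F : ∀ H → Indicator (InF n t H × DegSeq H d) (indicator (forestDeg? c H))
        𝟙F H = Indicator-⇔ (indicator-spec (forestDeg? c H))
          (λ (F , deg-H) → Equivalence.from (inF⇔partialForest t≤n H) F ,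
                           (λ v → trans (deg≡degree H v) (trans (deg-H v) (sym (d≡ v)))))
          (λ (I , D) → Equivalence.to (inF⇔partialForest t≤n H) I ,
                       (λ v → trans (sym (deg≡degree H v)) (trans (D v) (d≡ v))))

      outcomes-of-vector≡balls : ∀ c → (∀ v → d v ≡ c v + toℕᵇ (nonRoot v)) →
        ∀ {kB} → Count (BallVecIs {m} {n} {t} d) (outcomes m n t) kB → kB ≡ ballsMatching m c
      outcomes-of-vector≡balls c d≡ count = count≡sumList _ count 𝟙B
        where
        𝟙B : ∀ o → Indicator (BallVecIs d o) (indicator (occupancy≡? c o))
        𝟙B o = Indicator-⇔ (indicator-spec (occupancy≡? c o))
          (λ occ v → trans (ballVec≡occupancy+nonRoot o v) (trans (cong (_+ toℕᵇ (nonRoot v)) (occ v)) (sym (d≡ v))))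
          (λ vec v → +-cancelʳ-≡ (toℕᵇ (nonRoot v)) _ _ (trans (sym (ballVec≡occupancy+nonRoot o v)) (trans (vec v) (d≡ v))))

      forests-of-degree≡outcomes-of-vector : ∀ {kF kB} →
        Count (λ G → InF n t G × DegSeq G d) (allAdj n) kF →
        Count (BallVecIs {m} {n} {t} d) (outcomes m n t) kB → kF ≡ kB
      forests-of-degree≡outcomes-of-vector countF countB
        with Finₚ.any? (λ v → ¬? (toℕ v <? t) ×-dec (d v ≟ 0))
      ... | yes (v , v≮t , dv≡0) = trans (count-none countF no-forest) (sym (count-none countB no-outcome))
        where
        no-forest : ∀ H → ¬ (InF n t H × DegSeq H d)
        no-forest H (I , D) = let (u , Hvu) = active-has-neighbour (Equivalence.to (inF⇔partialForest t≤n H) I)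
                                                onlyNonRoots v (nonRoot-nonroot v v≮t)
          in <⇒≱ (neighbour⇒degree≥1 H v u Hvu) (≤-reflexive (trans (sym (deg≡degree H v)) (trans (D v) dv≡0)))
        no-outcome : ∀ o → ¬ BallVecIs d o
        no-outcome o vec = 1+n≢0 (trans (sym (+-comm (occupancy o v) 1))
          (trans (cong (occupancy o v +_) (cong toℕᵇ (sym (nonRoot-nonroot v v≮t))))
                 (trans (sym (ballVec≡occupancy+nonRoot o v)) (trans (vec v) dv≡0))))
      ... | no positive = trans (forests-of-degree≡balls c d≡ countF) (sym (outcomes-of-vector≡balls c d≡ countB))
        where
        c : Fin n → ℕ
        c v = d v ∸ toℕᵇ (nonRoot v)
        d≡ : ∀ v → d v ≡ c v + toℕᵇ (nonRoot v)
        d≡ v with toℕ v <? t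
        ... | yes _ = sym (+-identityʳ _)
        ... | no v≮t with d v in dv
        ...   | zero  = ⊥-elim (positive (v , v≮t , dv))
        ...   | suc k = +-comm 1 k

≤∸1⇒< : ∀ {t} n → 1 ≤ t → t ≤ n ∸ 1 → t < n
≤∸1⇒< zero    1≤t t≤0 = ⊥-elim (<⇒≱ 1≤t t≤0)
≤∸1⇒< (suc n) _   t≤n = s≤s t≤n

theorem6p2 : (n t : ℕ) → 1 ≤ t → t ≤ n ∸ 1 →
    (d : Fin n → ℕ) → (N kF kB : ℕ) →
    Count (InF n t) (allAdj n) N →
    Count (λ G → InF n t G × DegSeq G d) (allAdj n) kF →
    Count (BallVecIs {n ∸ t ∸ 1} {n} {t} d) (outcomes (n ∸ t ∸ 1) n t) kB →
    kF * length (outcomes (n ∸ t ∸ 1) n t) ≡ kB * N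
theorem6p2 n t 1≤t t≤n∸1 d N kF kB countN countF countB = cong₂ _*_
  (forests-of-degree≡outcomes-of-vector t<n d countF countB)
  (sym (forests≡outcomes t<n countN))
  where
  open Forests n t
  t<n : t < n
  t<n = ≤∸1⇒< n 1≤t t≤n∸1
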